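{- There exists an infinite class of 4-planar graphs such that no graph in the class admits a planar octilinear drawing without bends, and every planar octilinear drawing with at most one bend per edge of a graph in the class with $n$ vertices has $\Omega(n)$ bends in total.
   Context: A $k$-planar graph is a planar graph in which every vertex has degree at most $k$. An octilinear drawing of a graph of maximum degree at most eight is a drawing in which each vertex is placed at a point of the integer grid and each edge is drawn as a polygonal chain consisting of horizontal, vertical and diagonal (slope $\pm 1$) line segments; a bend is a point where two consecutive segments of an edge meet. The drawing is planar if no two edges cross except at common endpoints. -}

module Defs where

open import Data.Nat as ℕ using (ℕ; zero; suc)
open import Data.Integer as ℤ using (ℤ)
open import Data.Rational as ℚ using (ℚ; 0ℚ; 1ℚ)
open import Data.Fin using (Fin; _≟_)
open import Data.List using (List; []; _∷_; _++_; [_]; length; filter; map; allFin)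
open import Data.Nat.ListAction using (sum)
open import Data.Product using (Σ; _×_; _,_; ∃)
open import Data.Sum using (_⊎_)
open import Data.Empty using (⊥)
open import Data.Unit using (⊤)
open import Relation.Nullary using (¬_)
open import Relation.Nullary.Decidable using (_⊎-dec_)
open import Relation.Binary.PropositionalEquality using (_≡_; _≢_)

record Graph : Set where
  field
    V : ℕ
    E : ℕ
    src tgt : Fin E → Fin V
    loopless : ∀ e → src e ≢ tgt e
    noParallel : ∀ e f →
      ((src e ≡ src f × tgt e ≡ tgt f) ⊎ (src e ≡ tgt f × tgt e ≡ src f)) → e ≡ f
open Graph public

Incident : (G : Graph) → Fin (E G) → Fin (V G) → Set
Incident G e v = src G e ≡ v ⊎ tgt G e ≡ v

degree : (G : Graph) → Fin (V G) → ℕ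
degree G v = length (filter (λ e → (src G e ≟ v) ⊎-dec (tgt G e ≟ v)) (allFin (E G)))

MaxDegreeAtMost : ℕ → Graph → Set
MaxDegreeAtMost k G = ∀ v → degree G v ℕ.≤ k

Point : Set
Point = ℚ × ℚ

OnSeg : Point → Point → Point → Set
OnSeg (px , py) (ax , ay) (bx , by) =
  Σ ℚ λ t → (0ℚ ℚ.≤ t) × (t ℚ.≤ 1ℚ) ×
    (px ≡ ax ℚ.+ t ℚ.* (bx ℚ.- ax)) × (py ≡ ay ℚ.+ t ℚ.* (by ℚ.- ay))

OnPoly : Point → List Point → Set
OnPoly p [] = ⊥
OnPoly p (a ∷ []) = ⊥
OnPoly p (a ∷ b ∷ rest) = OnSeg p a b ⊎ OnPoly p (b ∷ rest)

SimplePoly : List Point → Set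
SimplePoly [] = ⊤
SimplePoly (a ∷ []) = ⊤
SimplePoly (a ∷ b ∷ rest) =
  (a ≢ b) × (∀ p → OnSeg p a b → OnPoly p (b ∷ rest) → p ≡ b) × SimplePoly (b ∷ rest)

AllSegs : (Point → Point → Set) → List Point → Set
AllSegs P [] = ⊤
AllSegs P (a ∷ []) = ⊤
AllSegs P (a ∷ b ∷ rest) = P a b × AllSegs P (b ∷ rest)

OctilinearSeg : Point → Point → Set
OctilinearSeg (ax , ay) (bx , by) =
  (dx ≡ 0ℚ) ⊎ (dy ≡ 0ℚ) ⊎ (dx ≡ dy) ⊎ (dx ≡ ℚ.- dy)
  where
  dx = bx ℚ.- ax
  dy = by ℚ.- ay

record Drawing (G : Graph) : Set where
  field
    pos   : Fin (V G) → Point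
    bends : Fin (E G) → List Point     -- bend points of edge e, in order from src to tgt
open Drawing public

arc : {G : Graph} → Drawing G → Fin (E G) → List Point
arc {G} D e = pos D (src G e) ∷ (bends D e ++ [ pos D (tgt G e) ])

PlanarDrawing : {G : Graph} → Drawing G → Set
PlanarDrawing {G} D =
  (∀ u v → pos D u ≡ pos D v → u ≡ v) ×
  (∀ e → SimplePoly (arc D e)) ×
  (∀ e w → ¬ Incident G e w → ¬ OnPoly (pos D w) (arc D e)) ×
  (∀ e f p → e ≢ f → OnPoly p (arc D e) → OnPoly p (arc D f) →
     Σ (Fin (V G)) λ w → (p ≡ pos D w) × Incident G e w × Incident G f w)

Planar : Graph → Set
Planar G = Σ (Drawing G) PlanarDrawing

KPlanar : ℕ → Graph → Set
KPlanar k G = Planar G × MaxDegreeAtMost k G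

fromℤ : ℤ → ℚ
fromℤ z = z ℚ./ 1

OnGrid : {G : Graph} → Drawing G → Set
OnGrid {G} D = ∀ v → Σ ℤ λ x → Σ ℤ λ y → pos D v ≡ (fromℤ x , fromℤ y)

OctilinearDrawing : {G : Graph} → Drawing G → Set
OctilinearDrawing {G} D = OnGrid D × (∀ e → AllSegs OctilinearSeg (arc D e))

PlanarOctilinear : {G : Graph} → Drawing G → Set
PlanarOctilinear D = OctilinearDrawing D × PlanarDrawing D

BendFree : {G : Graph} → Drawing G → Set
BendFree {G} D = ∀ e → bends D e ≡ []

AtMostOneBendPerEdge : {G : Graph} → Drawing G → Set
AtMostOneBendPerEdge {G} D = ∀ e → length (bends D e) ℕ.≤ 1

totalBends : {G : Graph} → Drawing G → ℕ
totalBends {G} D = sum (map (λ e → length (bends D e)) (allFin (E G)))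

module Submission where

-- A planar octilinear drawing of K₄ without bends is impossible. Edges at a common vertex have
-- different directions, for otherwise three vertices would be collinear and one of them would lie
-- on the edge joining the other two. So a direction is shared by at most two edges, which are then
-- opposite, and as there are only four directions, two of the three pairs of opposite edges are
-- parallel. The four vertices then form a parallelogram whose diagonals, the third pair, cross.
-- Hence in every planar octilinear drawing of k disjoint copies of K₄, a graph with 4k vertices
-- and maximum degree 3, each copy contains a bend. The copies are drawn planarly side by side,
-- each as a triangle with one vertex inside.

open import Defs

module Plane where

  open import Data.Fin using (Fin; zero; suc)
  open import Data.Product using (Σ; _×_; _,_; proj₁; proj₂)
  open import Data.Sum using (_⊎_; inj₁; inj₂)
  open import Data.Empty using (⊥-elim)
  open import Data.Unit using (tt)
  open import Function using (_∘_)
  open import Relation.Binary using (tri<; tri≈; tri>)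
  open import Relation.Binary.PropositionalEquality
  open import Relation.Nullary using (¬_; Dec; yes; no)
  open import Relation.Nullary.Decidable using (toWitness; _×-dec_; _⊎-dec_)
  open import Data.Rational using (ℚ; 0ℚ; 1ℚ; ½; _+_; _*_; _-_; -_; _<_; _≤_; 1/_; nonNegative; positive; ≢-nonZero)
  open import Data.Rational.Properties
  open import Algebra.Properties.Group +-0-group using () renaming (x∙y⁻¹≈ε⇒x≈y to p-q≡0⇒p≡q)
  open import Data.Rational.Solver using (module +-*-Solver)
  open +-*-Solver

  0≤q-p : ∀ {p q} → p ≤ q → 0ℚ ≤ q - p
  0≤q-p {p} {q} p≤q = subst (_≤ q - p) (+-inverseʳ p) (+-monoˡ-≤ (- p) p≤q)

  convex : ∀ t u v → u + t * (v - u) ≡ (1ℚ - t) * u + t * v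
  convex = solve 3 (λ t u v → u :+ t :* (v :- u) := (con 1ℚ :- t) :* u :+ t :* v) refl

  convex-const : ∀ t k → (1ℚ - t) * k + t * k ≡ k
  convex-const = solve 2 (λ t k → (con 1ℚ :- t) :* k :+ t :* k := k) refl

  lerp-≤ : ∀ {t u v k} → 0ℚ ≤ t → t ≤ 1ℚ → u ≤ k → v ≤ k → u + t * (v - u) ≤ k
  lerp-≤ {t} {u} {v} {k} 0≤t t≤1 u≤k v≤k = begin
    u + t * (v - u)       ≡⟨ convex t u v ⟩
    (1ℚ - t) * u + t * v  ≤⟨ +-mono-≤ (*-monoˡ-≤-nonNeg (1ℚ - t) {{nonNegative (0≤q-p t≤1)}} u≤k)
                                      (*-monoˡ-≤-nonNeg t {{nonNegative 0≤t}} v≤k) ⟩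
    (1ℚ - t) * k + t * k  ≡⟨ convex-const t k ⟩
    k                     ∎
    where open ≤-Reasoning

  lerp-≥ : ∀ {t u v k} → 0ℚ ≤ t → t ≤ 1ℚ → k ≤ u → k ≤ v → k ≤ u + t * (v - u)
  lerp-≥ {t} {u} {v} {k} 0≤t t≤1 k≤u k≤v = begin
    k                     ≡⟨ convex-const t k ⟨
    (1ℚ - t) * k + t * k  ≤⟨ +-mono-≤ (*-monoˡ-≤-nonNeg (1ℚ - t) {{nonNegative (0≤q-p t≤1)}} k≤u)
                                      (*-monoˡ-≤-nonNeg t {{nonNegative 0≤t}} k≤v) ⟩
    (1ℚ - t) * u + t * v  ≡⟨ convex t u v ⟨
    u + t * (v - u)       ∎
    where open ≤-Reasoning

  lerp-pos : ∀ {t u v} → 0ℚ ≤ t → t ≤ 1ℚ → 0ℚ < u → 0ℚ < v → 0ℚ < u + t * (v - u)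
  lerp-pos {u = u} {v} 0≤t t≤1 0<u 0<v with u ≤? v
  ... | yes u≤v = <-≤-trans 0<u (lerp-≥ 0≤t t≤1 ≤-refl u≤v)
  ... | no u≰v = <-≤-trans 0<v (lerp-≥ 0≤t t≤1 (<⇒≤ (≰⇒> u≰v)) ≤-refl)

  onSeg-sym : ∀ {p a b} → OnSeg p a b → OnSeg p b a
  onSeg-sym {a = ax , ay} {bx , by} (t , 0≤t , t≤1 , ex , ey) =
    1ℚ - t , 0≤q-p t≤1 , 1-t≤1 , trans ex (flip ax bx) , trans ey (flip ay by)
    where
    flip : ∀ a b → a + t * (b - a) ≡ b + (1ℚ - t) * (a - b)
    flip = solve 3 (λ t a b → a :+ t :* (b :- a) := b :+ (con 1ℚ :- t) :* (a :- b)) refl t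
    1-t≤1 : 1ℚ - t ≤ 1ℚ
    1-t≤1 = subst (1ℚ - t ≤_) (+-identityʳ 1ℚ) (+-monoʳ-≤ 1ℚ (neg-antimono-≤ 0≤t))

  onSeg-start : ∀ {p a b} → (s : OnSeg p a b) → proj₁ s ≡ 0ℚ → p ≡ a
  onSeg-start {a = ax , ay} {bx , by} (t , _ , _ , ex , ey) refl =
    cong₂ _,_ (trans ex (at0 ax bx)) (trans ey (at0 ay by))
    where
    at0 : ∀ a b → a + 0ℚ * (b - a) ≡ a
    at0 = solve 2 (λ a b → a :+ con 0ℚ :* (b :- a) := a) refl

  onSeg-x≤ : ∀ {p a b k} → OnSeg p a b → proj₁ a ≤ k → proj₁ b ≤ k → proj₁ p ≤ k
  onSeg-x≤ (t , 0≤t , t≤1 , ex , _) a≤k b≤k = subst (_≤ _) (sym ex) (lerp-≤ 0≤t t≤1 a≤k b≤k)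

  onSeg-x≥ : ∀ {p a b k} → OnSeg p a b → k ≤ proj₁ a → k ≤ proj₁ b → k ≤ proj₁ p
  onSeg-x≥ (t , 0≤t , t≤1 , ex , _) k≤a k≤b = subst (_ ≤_) (sym ex) (lerp-≥ 0≤t t≤1 k≤a k≤b)

  -- Twice the signed area of the triangle a b p: an affine function of p vanishing on the line a b.
  orient : Point → Point → Point → ℚ
  orient (ax , ay) (bx , by) (px , py) = (bx - ax) * (py - ay) - (by - ay) * (px - ax)

  orient-lerp : ∀ a b {p c d} → (s : OnSeg p c d) →
    orient a b p ≡ orient a b c + proj₁ s * (orient a b d - orient a b c)
  orient-lerp (ax , ay) (bx , by) {px , py} {cx , cy} {dx , dy} (t , _ , _ , ex , ey) =
    trans (cong₂ (λ x y → orient (ax , ay) (bx , by) (x , y)) ex ey)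
          (solve 9 (λ ax ay bx by cx cy dx dy t →
              (bx :- ax) :* ((cy :+ t :* (dy :- cy)) :- ay) :- (by :- ay) :* ((cx :+ t :* (dx :- cx)) :- ax)
           := ((bx :- ax) :* (cy :- ay) :- (by :- ay) :* (cx :- ax))
              :+ t :* (((bx :- ax) :* (dy :- ay) :- (by :- ay) :* (dx :- ax))
                       :- ((bx :- ax) :* (cy :- ay) :- (by :- ay) :* (cx :- ax)))) refl
            ax ay bx by cx cy dx dy t)

  orient-start : ∀ a b → orient a b a ≡ 0ℚ
  orient-start (ax , ay) (bx , by) =
    solve 4 (λ ax ay bx by → (bx :- ax) :* (ay :- ay) :- (by :- ay) :* (ax :- ax) := con 0ℚ) refl ax ay bx by

  orient-end : ∀ a b → orient a b b ≡ 0ℚ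
  orient-end (ax , ay) (bx , by) =
    solve 4 (λ ax ay bx by → (bx :- ax) :* (by :- ay) :- (by :- ay) :* (bx :- ax) := con 0ℚ) refl ax ay bx by

  onSeg-orient≡0 : ∀ {p a b} → OnSeg p a b → orient a b p ≡ 0ℚ
  onSeg-orient≡0 {p} {a} {b} s = begin
    orient a b p                                            ≡⟨ orient-lerp a b {p} {a} {b} s ⟩
    orient a b a + t * (orient a b b - orient a b a)        ≡⟨ cong₂ (λ u v → u + t * (v - u)) (orient-start a b) (orient-end a b) ⟩
    0ℚ + t * (0ℚ - 0ℚ)                                      ≡⟨ solve 1 (λ t → con 0ℚ :+ t :* (con 0ℚ :- con 0ℚ) := con 0ℚ) refl t ⟩
    0ℚ                                                      ∎
    where
    open ≡-Reasoning
    t = proj₁ s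

  off-segment : ∀ {w a b} → orient a b w ≢ 0ℚ → ¬ OnSeg w a b
  off-segment {w} {a} {b} orient≢0 = orient≢0 ∘ onSeg-orient≡0 {w} {a} {b}

  *-cancelʳ-≡0 : ∀ {t u} → t * u ≡ 0ℚ → u ≢ 0ℚ → t ≡ 0ℚ
  *-cancelʳ-≡0 {t} {u} tu≡0 u≢0 = begin
    t                ≡⟨ *-identityʳ t ⟨
    t * 1ℚ           ≡⟨ cong (t *_) (*-inverseʳ u) ⟨
    t * (u * 1/ u)   ≡⟨ *-assoc t u (1/ u) ⟨
    t * u * 1/ u     ≡⟨ cong (_* 1/ u) tu≡0 ⟩
    0ℚ * 1/ u        ≡⟨ *-zeroˡ (1/ u) ⟩
    0ℚ               ∎
    where
    open ≡-Reasoning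
    instance _ = ≢-nonZero u≢0

  fan-apex : ∀ {p a b c} → orient a b c ≢ 0ℚ → OnSeg p a b → OnSeg p a c → p ≡ a
  fan-apex {p} {a} {b} {c} orient≢0 on-ab on-ac = onSeg-start {p} {a} {c} on-ac (*-cancelʳ-≡0 t*orient≡0 orient≢0)
    where
    t = proj₁ on-ac
    t*orient≡0 : t * orient a b c ≡ 0ℚ
    t*orient≡0 = begin
      t * orient a b c                          ≡⟨ solve 2 (λ t u → t :* u := con 0ℚ :+ t :* (u :- con 0ℚ)) refl t (orient a b c) ⟩
      0ℚ + t * (orient a b c - 0ℚ)              ≡⟨ cong (λ z → z + t * (orient a b c - z)) (orient-start a b) ⟨
      orient a b a + t * (orient a b c - orient a b a)  ≡⟨ orient-lerp a b {p} {a} {c} on-ac ⟨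
      orient a b p                              ≡⟨ onSeg-orient≡0 {p} {a} {b} on-ab ⟩
      0ℚ                                        ∎
      where open ≡-Reasoning

  beside-disjoint : ∀ {p a b c d} → 0ℚ < orient a b c → 0ℚ < orient a b d → OnSeg p a b → ¬ OnSeg p c d
  beside-disjoint {p} {a} {b} {c} {d} 0<c 0<d on-ab on-cd@(t , 0≤t , t≤1 , _) =
    <-irrefl (sym (onSeg-orient≡0 {p} {a} {b} on-ab)) (subst (0ℚ <_) (sym (orient-lerp a b {p} {c} {d} on-cd)) (lerp-pos 0≤t t≤1 0<c 0<d))

  StrictlyBeside : Point → Point → Point → Point → Set
  StrictlyBeside a b c d = (0ℚ < orient a b c × 0ℚ < orient a b d) ⊎ (0ℚ < orient b a c × 0ℚ < orient b a d)

  strictlyBeside? : ∀ a b c d → Dec (StrictlyBeside a b c d)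
  strictlyBeside? a b c d = ((0ℚ <? orient a b c) ×-dec (0ℚ <? orient a b d)) ⊎-dec ((0ℚ <? orient b a c) ×-dec (0ℚ <? orient b a d))

  strictlyBeside-disjoint : ∀ {p a b c d} → StrictlyBeside a b c d → OnSeg p a b → ¬ OnSeg p c d
  strictlyBeside-disjoint {p} {a} {b} {c} {d} (inj₁ (0<c , 0<d)) on-ab = beside-disjoint {p} {a} {b} {c} {d} 0<c 0<d on-ab
  strictlyBeside-disjoint {p} {a} {b} {c} {d} (inj₂ (0<c , 0<d)) on-ab =
    beside-disjoint {p} {b} {a} {c} {d} 0<c 0<d (onSeg-sym {p} {a} {b} on-ab)

  Direction : Set
  Direction = Fin 4

  pattern vertical     = zero
  pattern horizontal   = suc zero
  pattern diagonal     = suc (suc zero)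
  pattern antidiagonal = suc (suc (suc zero))

  -- The lines of direction c are the level sets of form c.
  form : Direction → Point → ℚ
  form vertical     (x , y) = x
  form horizontal   (x , y) = y
  form diagonal     (x , y) = x - y
  form antidiagonal (x , y) = x + y

  Aligned : Point → Point → Set
  Aligned p q = Σ Direction λ c → form c p ≡ form c q

  aligned-sym : ∀ {p q} → Aligned p q → Aligned q p
  aligned-sym (c , eq) = c , sym eq

  octilinear⇒aligned : ∀ {p q} → OctilinearSeg p q → Aligned p q
  octilinear⇒aligned {px , py} {qx , qy} (inj₁ dx≡0) = vertical , sym (p-q≡0⇒p≡q qx px dx≡0)
  octilinear⇒aligned {px , py} {qx , qy} (inj₂ (inj₁ dy≡0)) = horizontal , sym (p-q≡0⇒p≡q qy py dy≡0)
  octilinear⇒aligned {px , py} {qx , qy} (inj₂ (inj₂ (inj₁ dx≡dy))) = diagonal , p-q≡0⇒p≡q _ _ (begin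
    (px - py) - (qx - qy)              ≡⟨ solve 4 (λ px py qx qy → (px :- py) :- (qx :- qy) := (qy :- py) :- (qx :- px)) refl px py qx qy ⟩
    (qy - py) - (qx - px)              ≡⟨ cong (_- (qx - px)) (sym dx≡dy) ⟩
    (qx - px) - (qx - px)              ≡⟨ +-inverseʳ (qx - px) ⟩
    0ℚ                                 ∎)
    where open ≡-Reasoning
  octilinear⇒aligned {px , py} {qx , qy} (inj₂ (inj₂ (inj₂ dx≡-dy))) = antidiagonal , p-q≡0⇒p≡q _ _ (begin
    (px + py) - (qx + qy)              ≡⟨ solve 4 (λ px py qx qy → (px :+ py) :- (qx :+ qy) := (:- (qy :- py)) :- (qx :- px)) refl px py qx qy ⟩
    - (qy - py) - (qx - px)            ≡⟨ cong (_- (qx - px)) (sym dx≡-dy) ⟩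
    (qx - px) - (qx - px)              ≡⟨ +-inverseʳ (qx - px) ⟩
    0ℚ                                 ∎)
    where open ≡-Reasoning

  _+ₚ_ : Point → Point → Point
  (a , b) +ₚ (c , d) = a + c , b + d

  _·ₚ_ : ℚ → Point → Point
  s ·ₚ (a , b) = s * a , s * b

  form-+ : ∀ c p q → form c (p +ₚ q) ≡ form c p + form c q
  form-+ vertical     p q = refl
  form-+ horizontal   p q = refl
  form-+ diagonal     (a , b) (c , d) = solve 4 (λ a b c d → (a :+ c) :- (b :+ d) := (a :- b) :+ (c :- d)) refl a b c d
  form-+ antidiagonal (a , b) (c , d) = solve 4 (λ a b c d → (a :+ c) :+ (b :+ d) := (a :+ b) :+ (c :+ d)) refl a b c d

  -- Position along a line of direction c, and the step taken per unit of position.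
  coord : Direction → Point → ℚ
  coord vertical (x , y) = y
  coord _        (x , y) = x

  step : Direction → Point
  step vertical     = 0ℚ , 1ℚ
  step horizontal   = 1ℚ , 0ℚ
  step diagonal     = 1ℚ , 1ℚ
  step antidiagonal = 1ℚ , - 1ℚ

  on-line : ∀ c {p q} → form c p ≡ form c q → q ≡ p +ₚ ((coord c q - coord c p) ·ₚ step c)
  on-line vertical {px , py} {qx , qy} refl = cong₂ _,_
    (solve 2 (λ px d → px := px :+ d :* con 0ℚ) refl px (qy - py))
    (solve 2 (λ py qy → qy := py :+ (qy :- py) :* con 1ℚ) refl py qy)
  on-line horizontal {px , py} {qx , qy} refl = cong₂ _,_
    (solve 2 (λ px qx → qx := px :+ (qx :- px) :* con 1ℚ) refl px qx)
    (solve 2 (λ py d → py := py :+ d :* con 0ℚ) refl py (qx - px))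
  on-line diagonal {px , py} {qx , qy} eq = cong₂ _,_
    (solve 2 (λ px qx → qx := px :+ (qx :- px) :* con 1ℚ) refl px qx)
    (begin
      qy                           ≡⟨ solve 2 (λ qx qy → qy := qx :- (qx :- qy)) refl qx qy ⟩
      qx - (qx - qy)               ≡⟨ cong (λ z → qx - z) eq ⟨
      qx - (px - py)               ≡⟨ solve 3 (λ px py qx → qx :- (px :- py) := py :+ (qx :- px) :* con 1ℚ) refl px py qx ⟩
      py + (qx - px) * 1ℚ          ∎)
    where open ≡-Reasoning
  on-line antidiagonal {px , py} {qx , qy} eq = cong₂ _,_
    (solve 2 (λ px qx → qx := px :+ (qx :- px) :* con 1ℚ) refl px qx)
    (begin
      qy                           ≡⟨ solve 2 (λ qx qy → qy := (qx :+ qy) :- qx) refl qx qy ⟩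
      (qx + qy) - qx               ≡⟨ cong (_- qx) eq ⟨
      (px + py) - qx               ≡⟨ solve 3 (λ px py qx → (px :+ py) :- qx := py :+ (qx :- px) :* (:- con 1ℚ)) refl px py qx ⟩
      py + (qx - px) * - 1ℚ        ∎)
    where open ≡-Reasoning

  coord-injective : ∀ c {p q} → form c p ≡ form c q → coord c p ≡ coord c q → p ≡ q
  coord-injective c {px , py} {qx , qy} same-line same-coord = sym (begin
    (qx , qy)                                              ≡⟨ on-line c same-line ⟩
    (px , py) +ₚ ((coord c (qx , qy) - coord c (px , py)) ·ₚ step c)
                                                           ≡⟨ cong (λ z → (px , py) +ₚ ((z - coord c (px , py)) ·ₚ step c)) same-coord ⟨
    (px , py) +ₚ ((coord c (px , py) - coord c (px , py)) ·ₚ step c)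
                                                           ≡⟨ cong (λ z → (px , py) +ₚ (z ·ₚ step c)) (+-inverseʳ (coord c (px , py))) ⟩
    (px , py) +ₚ (0ℚ ·ₚ step c)                            ≡⟨ no-step (step c) ⟩
    (px , py)                                              ∎)
    where
    open ≡-Reasoning
    no-step : ∀ w → (px , py) +ₚ (0ℚ ·ₚ w) ≡ (px , py)
    no-step (wx , wy) = cong₂ _,_ (solve 2 (λ p w → p :+ con 0ℚ :* w := p) refl px wx)
                                  (solve 2 (λ p w → p :+ con 0ℚ :* w := p) refl py wy)

  ratio : ∀ {l L} → 0ℚ < l → l ≤ L → Σ ℚ λ t → 0ℚ ≤ t × t ≤ 1ℚ × t * L ≡ l
  ratio {l} {L} 0<l l≤L = l * 1/ L , 0≤t , t≤1 , t*L≡l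
    where
    instance
      L-pos = positive (<-≤-trans 0<l l≤L)
      L≢0 = pos⇒nonZero L
      1/L-pos = 1/pos⇒pos L
    0≤1/L : 0ℚ ≤ 1/ L
    0≤1/L = <⇒≤ (positive⁻¹ (1/ L))
    0≤t : 0ℚ ≤ l * 1/ L
    0≤t = subst (_≤ l * 1/ L) (*-zeroˡ (1/ L)) (*-monoʳ-≤-nonNeg (1/ L) {{nonNegative 0≤1/L}} (<⇒≤ 0<l))
    t≤1 : l * 1/ L ≤ 1ℚ
    t≤1 = subst (l * 1/ L ≤_) (*-inverseʳ L) (*-monoʳ-≤-nonNeg (1/ L) {{nonNegative 0≤1/L}} l≤L)
    t*L≡l : l * 1/ L * L ≡ l
    t*L≡l = trans (*-assoc l (1/ L) L) (trans (cong (l *_) (*-inverseˡ L)) (*-identityʳ l))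

  ascending⇒onSeg : ∀ c {p m q} → form c p ≡ form c m → form c p ≡ form c q →
    coord c p < coord c m → coord c m < coord c q → OnSeg m p q
  ascending⇒onSeg c {px , py} {mx , my} {qx , qy} pm pq p<m m<q =
    t , 0≤t , t≤1 , along proj₁ (λ _ _ _ → refl) , along proj₂ (λ _ _ _ → refl)
    where
    l = coord c (mx , my) - coord c (px , py)
    L = coord c (qx , qy) - coord c (px , py)
    0<l : 0ℚ < l
    0<l = <-respˡ-≡ (+-inverseʳ (coord c (px , py))) (+-monoˡ-< (- coord c (px , py)) p<m)
    l≤L : l ≤ L
    l≤L = +-monoˡ-≤ (- coord c (px , py)) (<⇒≤ m<q)
    r = ratio 0<l l≤L
    t = proj₁ r
    0≤t = proj₁ (proj₂ r)
    t≤1 = proj₁ (proj₂ (proj₂ r))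
    t*L≡l = proj₂ (proj₂ (proj₂ r))
    scaled : ∀ a w → a + t * ((a + L * w) - a) ≡ a + l * w
    scaled a w = trans (solve 4 (λ a t L w → a :+ t :* ((a :+ L :* w) :- a) := a :+ (t :* L) :* w) refl a t L w)
                       (cong (λ z → a + z * w) t*L≡l)
    along : (π : Point → ℚ) → (∀ p s w → π (p +ₚ (s ·ₚ w)) ≡ π p + s * π w) →
      π (mx , my) ≡ π (px , py) + t * (π (qx , qy) - π (px , py))
    along π π-linear = begin
      π (mx , my)                                       ≡⟨ cong π (on-line c pm) ⟩
      π ((px , py) +ₚ (l ·ₚ step c))                    ≡⟨ π-linear (px , py) l (step c) ⟩
      π (px , py) + l * π (step c)                      ≡⟨ scaled (π (px , py)) (π (step c)) ⟨
      π (px , py) + t * ((π (px , py) + L * π (step c)) - π (px , py))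
                                                        ≡⟨ cong (λ z → π (px , py) + t * (z - π (px , py))) (trans (sym (π-linear (px , py) L (step c))) (cong π (sym (on-line c pq)))) ⟩
      π (px , py) + t * (π (qx , qy) - π (px , py))     ∎
      where open ≡-Reasoning

  between⇒onSeg : ∀ c {m a b} → form c m ≡ form c a → form c m ≡ form c b →
    (coord c a < coord c m × coord c m < coord c b) ⊎ (coord c b < coord c m × coord c m < coord c a) →
    OnSeg m a b
  between⇒onSeg c {m} {a} {b} ma mb (inj₁ (a<m , m<b)) = ascending⇒onSeg c {a} {m} {b} (sym ma) (trans (sym ma) mb) a<m m<b
  between⇒onSeg c {m} {a} {b} ma mb (inj₂ (b<m , m<a)) =
    onSeg-sym {m} {b} {a} (ascending⇒onSeg c {b} {m} {a} (sym mb) (trans (sym mb) ma) b<m m<a)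

  aligned-triple : ∀ c {p q r} → p ≢ q → p ≢ r → q ≢ r → form c p ≡ form c q → form c p ≡ form c r →
    OnSeg q p r ⊎ OnSeg p q r ⊎ OnSeg r p q
  aligned-triple c {p} {q} {r} p≢q p≢r q≢r pq pr
    with <-cmp (coord c p) (coord c q) | <-cmp (coord c q) (coord c r) | <-cmp (coord c p) (coord c r)
  ... | tri≈ _ e _ | _ | _ = ⊥-elim (p≢q (coord-injective c pq e))
  ... | _ | tri≈ _ e _ | _ = ⊥-elim (q≢r (coord-injective c (trans (sym pq) pr) e))
  ... | _ | _ | tri≈ _ e _ = ⊥-elim (p≢r (coord-injective c pr e))
  ... | tri< p<q _ _ | tri< q<r _ _ | _           = inj₁ (between⇒onSeg c (sym pq) (trans (sym pq) pr) (inj₁ (p<q , q<r)))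
  ... | tri> _ _ q<p | tri> _ _ r<q | _           = inj₁ (between⇒onSeg c (sym pq) (trans (sym pq) pr) (inj₂ (r<q , q<p)))
  ... | tri< p<q _ _ | tri> _ _ r<q | tri< p<r _ _ = inj₂ (inj₂ (between⇒onSeg c (sym pr) (trans (sym pr) pq) (inj₁ (p<r , r<q))))
  ... | tri< p<q _ _ | tri> _ _ r<q | tri> _ _ r<p = inj₂ (inj₁ (between⇒onSeg c pq pr (inj₂ (r<p , p<q))))
  ... | tri> _ _ q<p | tri< q<r _ _ | tri< p<r _ _ = inj₂ (inj₁ (between⇒onSeg c pq pr (inj₁ (q<p , p<r))))
  ... | tri> _ _ q<p | tri< q<r _ _ | tri> _ _ r<p = inj₂ (inj₂ (between⇒onSeg c (sym pr) (trans (sym pr) pq) (inj₂ (q<r , r<p))))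

  rebuild : Direction → Direction → ℚ → ℚ → Point
  rebuild vertical     horizontal   u v = u , v
  rebuild horizontal   vertical     u v = v , u
  rebuild vertical     diagonal     u v = u , u - v
  rebuild diagonal     vertical     u v = v , v - u
  rebuild vertical     antidiagonal u v = u , v - u
  rebuild antidiagonal vertical     u v = v , u - v
  rebuild horizontal   diagonal     u v = v + u , u
  rebuild diagonal     horizontal   u v = u + v , v
  rebuild horizontal   antidiagonal u v = v - u , u
  rebuild antidiagonal horizontal   u v = u - v , v
  rebuild diagonal     antidiagonal u v = ½ * (u + v) , ½ * (v - u)
  rebuild antidiagonal diagonal     u v = ½ * (u + v) , ½ * (u - v)
  rebuild _            _            u v = u , v

  rebuild-form : ∀ c d → c ≢ d → ∀ p → rebuild c d (form c p) (form d p) ≡ p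
  rebuild-form vertical     vertical     c≢d _ = ⊥-elim (c≢d refl)
  rebuild-form horizontal   horizontal   c≢d _ = ⊥-elim (c≢d refl)
  rebuild-form diagonal     diagonal     c≢d _ = ⊥-elim (c≢d refl)
  rebuild-form antidiagonal antidiagonal c≢d _ = ⊥-elim (c≢d refl)
  rebuild-form vertical     horizontal   _ p = refl
  rebuild-form horizontal   vertical     _ p = refl
  rebuild-form vertical     diagonal     _ (x , y) = cong (x ,_) (solve 2 (λ x y → x :- (x :- y) := y) refl x y)
  rebuild-form diagonal     vertical     _ (x , y) = cong (x ,_) (solve 2 (λ x y → x :- (x :- y) := y) refl x y)
  rebuild-form vertical     antidiagonal _ (x , y) = cong (x ,_) (solve 2 (λ x y → (x :+ y) :- x := y) refl x y)
  rebuild-form antidiagonal vertical     _ (x , y) = cong (x ,_) (solve 2 (λ x y → (x :+ y) :- x := y) refl x y)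
  rebuild-form horizontal   diagonal     _ (x , y) = cong (_, y) (solve 2 (λ x y → (x :- y) :+ y := x) refl x y)
  rebuild-form diagonal     horizontal   _ (x , y) = cong (_, y) (solve 2 (λ x y → (x :- y) :+ y := x) refl x y)
  rebuild-form horizontal   antidiagonal _ (x , y) = cong (_, y) (solve 2 (λ x y → (x :+ y) :- y := x) refl x y)
  rebuild-form antidiagonal horizontal   _ (x , y) = cong (_, y) (solve 2 (λ x y → (x :+ y) :- y := x) refl x y)
  rebuild-form diagonal     antidiagonal _ (x , y) = cong₂ _,_
    (solve 2 (λ x y → con ½ :* ((x :- y) :+ (x :+ y)) := x) refl x y)
    (solve 2 (λ x y → con ½ :* ((x :+ y) :- (x :- y)) := y) refl x y)
  rebuild-form antidiagonal diagonal     _ (x , y) = cong₂ _,_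
    (solve 2 (λ x y → con ½ :* ((x :+ y) :+ (x :- y)) := x) refl x y)
    (solve 2 (λ x y → con ½ :* ((x :+ y) :- (x :- y)) := y) refl x y)

  form-injective : ∀ {c d} → c ≢ d → ∀ {p q} → form c p ≡ form c q → form d p ≡ form d q → p ≡ q
  form-injective {c} {d} c≢d {p} {q} ep eq = begin
    p                                    ≡⟨ rebuild-form c d c≢d p ⟨
    rebuild c d (form c p) (form d p)    ≡⟨ cong₂ (rebuild c d) ep eq ⟩
    rebuild c d (form c q) (form d q)    ≡⟨ rebuild-form c d c≢d q ⟩
    q                                    ∎
    where open ≡-Reasoning

  midpoint : Point → Point → Point
  midpoint a b = ½ ·ₚ (a +ₚ b)

  midpoint-onSeg : ∀ a b → OnSeg (midpoint a b) a b
  midpoint-onSeg (ax , ay) (bx , by) = ½ , toWitness {a? = 0ℚ ≤? ½} tt , toWitness {a? = ½ ≤? 1ℚ} tt , half ax bx , half ay by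
    where
    half : ∀ a b → ½ * (a + b) ≡ a + ½ * (b - a)
    half = solve 2 (λ a b → con ½ :* (a :+ b) := a :+ con ½ :* (b :- a)) refl

  -- a b a′ b′ is a parallelogram in this cyclic order, with sides along c and d.
  parallelogram-diagonals-meet : ∀ {c d} → c ≢ d → ∀ {a b a′ b′} →
    form c a ≡ form c b → form c a′ ≡ form c b′ → form d a ≡ form d b′ → form d a′ ≡ form d b →
    Σ Point λ p → OnSeg p a a′ × OnSeg p b b′
  parallelogram-diagonals-meet {c} {d} c≢d {a} {b} {a′} {b′} ab a′b′ ab′ a′b =
    midpoint a a′ , midpoint-onSeg a a′ , subst (λ m → OnSeg m b b′) (cong (½ ·ₚ_) (sym same-sum)) (midpoint-onSeg b b′)
    where
    same-sum : a +ₚ a′ ≡ b +ₚ b′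
    same-sum = form-injective c≢d
      (trans (form-+ c a a′) (trans (cong₂ _+_ ab a′b′) (sym (form-+ c b b′))))
      (trans (form-+ d a a′) (trans (cong₂ _+_ ab′ a′b) (trans (+-comm (form d b′) (form d b)) (sym (form-+ d b b′)))))

  _-ₚ_ : Point → Point → Point
  (a , b) -ₚ (c , d) = a - c , b - d

  -ₚ-+ₚ : ∀ p d → (p -ₚ d) +ₚ d ≡ p
  -ₚ-+ₚ (px , py) (dx , dy) = cong₂ _,_ (cancel px dx) (cancel py dy)
    where
    cancel : ∀ p d → (p - d) + d ≡ p
    cancel = solve 2 (λ p d → (p :- d) :+ d := p) refl

  +ₚ-injective : ∀ {p q} d → p +ₚ d ≡ q +ₚ d → p ≡ q
  +ₚ-injective {p} {q} d eq = begin
    p                 ≡⟨ -ₚ-+ₚ′ p ⟨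
    (p +ₚ d) -ₚ d     ≡⟨ cong (_-ₚ d) eq ⟩
    (q +ₚ d) -ₚ d     ≡⟨ -ₚ-+ₚ′ q ⟩
    q                 ∎
    where
    open ≡-Reasoning
    -ₚ-+ₚ′ : ∀ p → (p +ₚ d) -ₚ d ≡ p
    -ₚ-+ₚ′ (px , py) = cong₂ _,_ (solve 2 (λ p d → (p :+ d) :- d := p) refl px (proj₁ d))
                                 (solve 2 (λ p d → (p :+ d) :- d := p) refl py (proj₂ d))

  onSeg-translate : ∀ {p a b} d → OnSeg p (a +ₚ d) (b +ₚ d) → OnSeg (p -ₚ d) a b
  onSeg-translate {px , py} {ax , ay} {bx , by} (dx , dy) (t , 0≤t , t≤1 , ex , ey) =
    t , 0≤t , t≤1 , shift {a = ax} {bx} {dx} ex , shift {a = ay} {by} {dy} ey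
    where
    shift : ∀ {p a b d} → p ≡ (a + d) + t * ((b + d) - (a + d)) → p - d ≡ a + t * (b - a)
    shift {p} {a} {b} {d} refl = solve 4 (λ a b d t → ((a :+ d) :+ t :* ((b :+ d) :- (a :+ d))) :- d := a :+ t :* (b :- a)) refl a b d t

  onSeg-translate⁻ : ∀ {p a b} d → OnSeg (p +ₚ d) (a +ₚ d) (b +ₚ d) → OnSeg p a b
  onSeg-translate⁻ {p} {a} {b} d s = subst (λ q → OnSeg q a b) (+ₚ-injective d (-ₚ-+ₚ (p +ₚ d) d)) (onSeg-translate {p +ₚ d} {a} {b} d s)

module Configurations where

  open Plane
  open import Data.Fin using (Fin; zero; suc; _≟_)
  open import Data.Fin.Properties using (injective⇒≤)
  open import Data.Nat using (_≤_)
  open import Data.Nat.Properties using (1+n≰n)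
  open import Data.Product using (Σ; _×_; _,_; proj₁; proj₂)
  open import Data.Sum using (_⊎_; inj₁; inj₂)
  open import Data.Empty using (⊥; ⊥-elim)
  open import Data.Vec using (Vec; []; _∷_)
  open import Data.Vec.Relation.Unary.All using ([]; _∷_)
  open import Data.Vec.Relation.Unary.AllPairs using ([]; _∷_)
  open import Data.Vec.Relation.Unary.Unique.Propositional using (Unique)
  open import Data.Vec.Relation.Unary.Unique.Propositional.Properties using (lookup-injective)
  open import Function using (_∘_)
  open import Relation.Binary.PropositionalEquality
  open import Relation.Nullary using (¬_; yes; no)
  open import Relation.Nullary.Decidable using (False; toWitnessFalse)

  unique⇒length≤ : ∀ {m n} {xs : Vec (Fin m) n} → Unique xs → n ≤ m
  unique⇒length≤ u = injective⇒≤ (lookup-injective u _ _)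

  -- If two of the pairs were not constant, five of the directions would be pairwise distinct.
  two-constant-pairs : ∀ {a a′ b b′ c c′ : Direction} →
    a ≢ b → a ≢ b′ → a′ ≢ b → a′ ≢ b′ → a ≢ c → a ≢ c′ → a′ ≢ c → a′ ≢ c′ →
    b ≢ c → b ≢ c′ → b′ ≢ c → b′ ≢ c′ →
    (a ≡ a′ × b ≡ b′) ⊎ (a ≡ a′ × c ≡ c′) ⊎ (b ≡ b′ × c ≡ c′)
  two-constant-pairs {a} {a′} {b} {b′} {c} {c′} ab ab′ a′b a′b′ ac ac′ a′c a′c′ bc bc′ b′c b′c′
    with a ≟ a′ | b ≟ b′ | c ≟ c′
  ... | yes aa′ | yes bb′ | _       = inj₁ (aa′ , bb′)
  ... | yes aa′ | no _    | yes cc′ = inj₂ (inj₁ (aa′ , cc′))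
  ... | no _    | yes bb′ | yes cc′ = inj₂ (inj₂ (bb′ , cc′))
  ... | no a≢a′ | no b≢b′ | _       = ⊥-elim (1+n≰n (unique⇒length≤ {xs = a ∷ a′ ∷ b ∷ b′ ∷ c ∷ []}
    ((a≢a′ ∷ ab ∷ ab′ ∷ ac ∷ []) ∷ (a′b ∷ a′b′ ∷ a′c ∷ []) ∷ (b≢b′ ∷ bc ∷ []) ∷ (b′c ∷ []) ∷ [] ∷ [])))
  ... | no a≢a′ | _       | no c≢c′ = ⊥-elim (1+n≰n (unique⇒length≤ {xs = a ∷ a′ ∷ c ∷ c′ ∷ b ∷ []}
    ((a≢a′ ∷ ac ∷ ac′ ∷ ab ∷ []) ∷ (a′c ∷ a′c′ ∷ a′b ∷ []) ∷ (c≢c′ ∷ ≢-sym bc ∷ []) ∷ (≢-sym bc′ ∷ []) ∷ [] ∷ [])))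
  ... | _       | no b≢b′ | no c≢c′ = ⊥-elim (1+n≰n (unique⇒length≤ {xs = b ∷ b′ ∷ c ∷ c′ ∷ a ∷ []}
    ((b≢b′ ∷ bc ∷ bc′ ∷ ≢-sym ab ∷ []) ∷ (b′c ∷ b′c′ ∷ ≢-sym ab′ ∷ []) ∷ (c≢c′ ∷ ≢-sym ac ∷ []) ∷ (≢-sym ac′ ∷ []) ∷ [] ∷ [])))

  record OctilinearK4 (P : Fin 4 → Point) : Set where
    field
      injective       : ∀ {i j} → P i ≡ P j → i ≡ j
      aligned         : ∀ {i j} → i ≢ j → Aligned (P i) (P j)
      vertex-off-edge : ∀ {i j k} → i ≢ j → i ≢ k → j ≢ k → ¬ OnSeg (P i) (P j) (P k)
      edges-disjoint  : ∀ {i j k l} → i ≢ j → k ≢ l → i ≢ k → i ≢ l → j ≢ k → j ≢ l →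
                        ∀ {p} → OnSeg p (P i) (P j) → ¬ OnSeg p (P k) (P l)

  pattern v₀ = zero
  pattern v₁ = suc zero
  pattern v₂ = suc (suc zero)
  pattern v₃ = suc (suc (suc zero))

  module _ {P : Fin 4 → Point} (K : OctilinearK4 P) where
    open OctilinearK4 K

    no-three-aligned : ∀ {i j k} c → i ≢ j → i ≢ k → j ≢ k →
      form c (P i) ≡ form c (P j) → form c (P i) ≡ form c (P k) → ⊥
    no-three-aligned {i} {j} {k} c i≢j i≢k j≢k ij ik
      with aligned-triple c {P i} {P j} {P k} (i≢j ∘ injective) (i≢k ∘ injective) (j≢k ∘ injective) ij ik
    ... | inj₁ j∈ik        = vertex-off-edge (≢-sym i≢j) j≢k i≢k j∈ik
    ... | inj₂ (inj₁ i∈jk) = vertex-off-edge i≢j i≢k j≢k i∈jk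
    ... | inj₂ (inj₂ k∈ij) = vertex-off-edge (≢-sym i≢k) (≢-sym j≢k) i≢j k∈ij

    fan : ∀ i j k {i≢j : False (i ≟ j)} {i≢k : False (i ≟ k)} {j≢k : False (j ≟ k)} {c d} →
      form c (P i) ≡ form c (P j) → form d (P i) ≡ form d (P k) → c ≢ d
    fan i j k {i≢j} {i≢k} {j≢k} {c} ij ik refl =
      no-three-aligned c (toWitnessFalse i≢j) (toWitnessFalse i≢k) (toWitnessFalse j≢k) ij ik

    diagonals-disjoint : ∀ i j k l {i≢j : False (i ≟ j)} {k≢l : False (k ≟ l)} {i≢k : False (i ≟ k)}
      {i≢l : False (i ≟ l)} {j≢k : False (j ≟ k)} {j≢l : False (j ≟ l)} →
      ¬ Σ Point (λ p → OnSeg p (P i) (P j) × OnSeg p (P k) (P l))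
    diagonals-disjoint i j k l {i≢j} {k≢l} {i≢k} {i≢l} {j≢k} {j≢l} (p , on-ij , on-kl) =
      edges-disjoint (toWitnessFalse i≢j) (toWitnessFalse k≢l) (toWitnessFalse i≢k)
                     (toWitnessFalse i≢l) (toWitnessFalse j≢k) (toWitnessFalse j≢l) on-ij on-kl

    private
      a₀₁ = aligned {v₀} {v₁} (λ ())
      a₀₂ = aligned {v₀} {v₂} (λ ())
      a₀₃ = aligned {v₀} {v₃} (λ ())
      a₁₂ = aligned {v₁} {v₂} (λ ())
      a₁₃ = aligned {v₁} {v₃} (λ ())
      a₂₃ = aligned {v₂} {v₃} (λ ())

      c₀₁ = proj₁ a₀₁ ; c₀₂ = proj₁ a₀₂ ; c₀₃ = proj₁ a₀₃ ; c₁₂ = proj₁ a₁₂ ; c₁₃ = proj₁ a₁₃ ; c₂₃ = proj₁ a₂₃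

      recolour : ∀ {c c′ p q} → c ≡ c′ → form c′ p ≡ form c′ q → form c p ≡ form c q
      recolour refl e = e

    -- The pairs of opposite edges are 01/23, 02/13 and 03/12.
    no-octilinear-K4 : ⊥
    no-octilinear-K4 with two-constant-pairs {c₀₁} {c₂₃} {c₀₂} {c₁₃} {c₀₃} {c₁₂}
      (fan v₀ v₁ v₂ (proj₂ a₀₁) (proj₂ a₀₂))             (fan v₁ v₀ v₃ (sym (proj₂ a₀₁)) (proj₂ a₁₃))
      (fan v₂ v₃ v₀ (proj₂ a₂₃) (sym (proj₂ a₀₂)))       (fan v₃ v₂ v₁ (sym (proj₂ a₂₃)) (sym (proj₂ a₁₃)))
      (fan v₀ v₁ v₃ (proj₂ a₀₁) (proj₂ a₀₃))             (fan v₁ v₀ v₂ (sym (proj₂ a₀₁)) (proj₂ a₁₂))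
      (fan v₃ v₂ v₀ (sym (proj₂ a₂₃)) (sym (proj₂ a₀₃))) (fan v₂ v₃ v₁ (proj₂ a₂₃) (sym (proj₂ a₁₂)))
      (fan v₀ v₂ v₃ (proj₂ a₀₂) (proj₂ a₀₃))             (fan v₂ v₀ v₁ (sym (proj₂ a₀₂)) (sym (proj₂ a₁₂)))
      (fan v₃ v₁ v₀ (sym (proj₂ a₁₃)) (sym (proj₂ a₀₃))) (fan v₁ v₃ v₂ (proj₂ a₁₃) (proj₂ a₁₂))
    ... | inj₁ (c₀₁≡c₂₃ , c₀₂≡c₁₃) = diagonals-disjoint v₀ v₃ v₁ v₂
      (parallelogram-diagonals-meet {c₀₁} {c₀₂} (fan v₀ v₁ v₂ (proj₂ a₀₁) (proj₂ a₀₂)) {P v₀} {P v₁} {P v₃} {P v₂}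
        (proj₂ a₀₁) (recolour c₀₁≡c₂₃ (sym (proj₂ a₂₃))) (proj₂ a₀₂) (recolour c₀₂≡c₁₃ (sym (proj₂ a₁₃))))
    ... | inj₂ (inj₁ (c₀₁≡c₂₃ , c₀₃≡c₁₂)) = diagonals-disjoint v₀ v₂ v₁ v₃
      (parallelogram-diagonals-meet {c₀₁} {c₀₃} (fan v₀ v₁ v₃ (proj₂ a₀₁) (proj₂ a₀₃)) {P v₀} {P v₁} {P v₂} {P v₃}
        (proj₂ a₀₁) (recolour c₀₁≡c₂₃ (proj₂ a₂₃)) (proj₂ a₀₃) (recolour c₀₃≡c₁₂ (sym (proj₂ a₁₂))))
    ... | inj₂ (inj₂ (c₀₂≡c₁₃ , c₀₃≡c₁₂)) = diagonals-disjoint v₀ v₁ v₂ v₃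
      (parallelogram-diagonals-meet {c₀₂} {c₀₃} (fan v₀ v₂ v₃ (proj₂ a₀₂) (proj₂ a₀₃)) {P v₀} {P v₂} {P v₁} {P v₃}
        (proj₂ a₀₂) (recolour c₀₂≡c₁₃ (proj₂ a₁₃)) (proj₂ a₀₃) (recolour c₀₃≡c₁₂ (proj₂ a₁₂)))

module Graphs where

  open Configurations using (v₀; v₁; v₂; v₃)
  open import Data.Nat using (ℕ; zero; suc; _+_; _≤_)
  open import Data.Fin using (Fin; zero; suc; _≟_; _↑ˡ_; _↑ʳ_; splitAt; join)
  open import Data.Fin.Properties using (all?; any?; ↑ˡ-injective; ↑ʳ-injective; splitAt-↑ˡ; splitAt-↑ʳ; join-splitAt)
  open import Data.List using ([]; _∷_; length; filter; tabulate; allFin; _++_)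
  open import Data.List.Properties using (filter-++; length-++; filter-none)
  open import Data.List.Relation.Unary.All.Properties using (tabulate⁺)
  open import Data.Vec using (lookup; _∷_; [])
  open import Data.Product using (∃; _×_; _,_)
  open import Data.Sum using (_⊎_; inj₁; inj₂; [_,_]′)
  import Data.Sum as Sum
  import Data.Product as Product
  open import Data.Empty using (⊥-elim)
  open import Data.Unit using (tt)
  open import Function using (_∘_)
  open import Relation.Binary.PropositionalEquality
  open import Relation.Nullary using (¬_; Dec; yes; no; ¬?)
  open import Relation.Nullary.Decidable using (toWitness; _×-dec_; _⊎-dec_; _→-dec_)
  open import Relation.Unary using (Pred; Decidable)
  open import Level using (0ℓ)
  open import Data.Nat.Properties using (+-identityʳ; _≤?_)

  SameEnds : ∀ {A : Set} → A → A → A → A → Set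
  SameEnds s t s′ t′ = (s ≡ s′ × t ≡ t′) ⊎ (s ≡ t′ × t ≡ s′)

  sameEnds-cong : ∀ {A : Set} {s t s′ t′ s₂ t₂ s₂′ t₂′ : A} →
    s ≡ s₂ → t ≡ t₂ → s′ ≡ s₂′ → t′ ≡ t₂′ → SameEnds s t s′ t′ → SameEnds s₂ t₂ s₂′ t₂′
  sameEnds-cong refl refl refl refl same = same

  sameEnds-injective : ∀ {A B : Set} {f : A → B} → (∀ {a b} → f a ≡ f b → a ≡ b) →
    ∀ {s t s′ t′} → SameEnds (f s) (f t) (f s′) (f t′) → SameEnds s t s′ t′
  sameEnds-injective f-inj = Sum.map (Product.map f-inj f-inj) (Product.map f-inj f-inj)

  sameEnds-disjoint : ∀ {A : Set} {s t s′ t′ : A} → s ≢ s′ → s ≢ t′ → ¬ SameEnds s t s′ t′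
  sameEnds-disjoint s≢s′ _ (inj₁ (s≡s′ , _)) = s≢s′ s≡s′
  sameEnds-disjoint _ s≢t′ (inj₂ (s≡t′ , _)) = s≢t′ s≡t′

  Joins : (G : Graph) → Fin (E G) → Fin (V G) → Fin (V G) → Set
  Joins G e u v = SameEnds (src G e) (tgt G e) u v

  joins-incident : ∀ {G e u v w} → Joins G e u v → Incident G e w → w ≡ u ⊎ w ≡ v
  joins-incident (inj₁ (refl , refl)) (inj₁ refl) = inj₁ refl
  joins-incident (inj₁ (refl , refl)) (inj₂ refl) = inj₂ refl
  joins-incident (inj₂ (refl , refl)) (inj₁ refl) = inj₂ refl
  joins-incident (inj₂ (refl , refl)) (inj₂ refl) = inj₁ refl

  joins-disjoint : ∀ {G e f i j k l w} → Joins G e i j → Joins G f k l →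
    i ≢ k → i ≢ l → j ≢ k → j ≢ l → Incident G e w → ¬ Incident G f w
  joins-disjoint {G} {e} {f} e-ij f-kl i≢k i≢l j≢k j≢l inc-e inc-f
    with joins-incident {G} {e} e-ij inc-e | joins-incident {G} {f} f-kl inc-f
  ... | inj₁ refl | inj₁ refl = i≢k refl
  ... | inj₁ refl | inj₂ refl = i≢l refl
  ... | inj₂ refl | inj₁ refl = j≢k refl
  ... | inj₂ refl | inj₂ refl = j≢l refl

  incident? : ∀ G e v → Dec (Incident G e v)
  incident? G e v = (src G e ≟ v) ⊎-dec (tgt G e ≟ v)

  empty : Graph
  empty = record { V = 0 ; E = 0 ; src = λ () ; tgt = λ () ; loopless = λ () ; noParallel = λ () }

  K4-src K4-tgt : Fin 6 → Fin 4
  K4-src = lookup (v₀ ∷ v₀ ∷ v₀ ∷ v₁ ∷ v₁ ∷ v₂ ∷ [])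
  K4-tgt = lookup (v₁ ∷ v₂ ∷ v₃ ∷ v₂ ∷ v₃ ∷ v₃ ∷ [])

  K4 : Graph
  K4 = record
    { V = 4 ; E = 6 ; src = K4-src ; tgt = K4-tgt
    ; loopless = toWitness {a? = all? λ e → ¬? (K4-src e ≟ K4-tgt e)} tt
    ; noParallel = toWitness {a? = all? λ e → all? λ f →
        (((K4-src e ≟ K4-src f) ×-dec (K4-tgt e ≟ K4-tgt f)) ⊎-dec ((K4-src e ≟ K4-tgt f) ×-dec (K4-tgt e ≟ K4-src f)))
        →-dec (e ≟ f)} tt
    }

  K4-complete : ∀ u v → u ≢ v → ∃ λ e → Joins K4 e u v
  K4-complete = toWitness {a? = all? λ u → all? λ v → ¬? (u ≟ v) →-dec any? λ e →
    ((K4-src e ≟ u) ×-dec (K4-tgt e ≟ v)) ⊎-dec ((K4-src e ≟ v) ×-dec (K4-tgt e ≟ u))} tt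

  K4-maxDegree : MaxDegreeAtMost 3 K4
  K4-maxDegree = toWitness {a? = all? λ v → degree K4 v ≤? 3} tt

  copair : ∀ {m n} {A : Set} → (Fin m → A) → (Fin n → A) → Fin (m + n) → A
  copair {m} f g i = [ f , g ]′ (splitAt m i)

  copair-↑ˡ : ∀ {m n} {A : Set} (f : Fin m → A) (g : Fin n → A) i → copair f g (i ↑ˡ n) ≡ f i
  copair-↑ˡ {m} {n} f g i = cong [ f , g ]′ (splitAt-↑ˡ m i n)

  copair-↑ʳ : ∀ {m n} {A : Set} (f : Fin m → A) (g : Fin n → A) j → copair f g (m ↑ʳ j) ≡ g j
  copair-↑ʳ {m} {n} f g j = cong [ f , g ]′ (splitAt-↑ʳ m n j)

  copair-elim : ∀ {m n} {A : Set} (P : A → Set) {f : Fin m → A} {g : Fin n → A} →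
    (∀ i → P (f i)) → (∀ j → P (g j)) → ∀ k → P (copair f g k)
  copair-elim {m} P Pf Pg k with splitAt m k
  ... | inj₁ i = Pf i
  ... | inj₂ j = Pg j

  data Side (m n : ℕ) : Fin (m + n) → Set where
    left  : ∀ i → Side m n (i ↑ˡ n)
    right : ∀ j → Side m n (m ↑ʳ j)

  side : ∀ m {n} i → Side m n i
  side m {n} i = subst (Side m n) (join-splitAt m n i) (from-sum (splitAt m i))
    where
    from-sum : ∀ s → Side m n (join m n s)
    from-sum (inj₁ i) = left i
    from-sum (inj₂ j) = right j

  ↑ˡ≢↑ʳ : ∀ {m n} {i : Fin m} {j : Fin n} → i ↑ˡ n ≢ m ↑ʳ j
  ↑ˡ≢↑ʳ {m} {n} {i} {j} eq with trans (sym (splitAt-↑ˡ m i n)) (trans (cong (splitAt m) eq) (splitAt-↑ʳ m n j))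
  ... | ()

  record _↪_ (G U : Graph) : Set where
    field
      vertex           : Fin (V G) → Fin (V U)
      edge             : Fin (E G) → Fin (E U)
      vertex-injective : ∀ {u v} → vertex u ≡ vertex v → u ≡ v
      edge-injective   : ∀ {e f} → edge e ≡ edge f → e ≡ f
      src-edge         : ∀ e → src U (edge e) ≡ vertex (src G e)
      tgt-edge         : ∀ e → tgt U (edge e) ≡ vertex (tgt G e)

    incident⁺ : ∀ {e w} → Incident G e w → Incident U (edge e) (vertex w)
    incident⁺ {e} = Sum.map (trans (src-edge e) ∘ cong vertex) (trans (tgt-edge e) ∘ cong vertex)

    incident⁻ : ∀ {e w} → Incident U (edge e) (vertex w) → Incident G e w
    incident⁻ {e} = Sum.map (vertex-injective ∘ trans (sym (src-edge e))) (vertex-injective ∘ trans (sym (tgt-edge e)))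

    incident-image : ∀ {e w} → Incident U (edge e) w → ∃ λ w′ → w ≡ vertex w′ × Incident G e w′
    incident-image {e} (inj₁ refl) = src G e , src-edge e , inj₁ refl
    incident-image {e} (inj₂ refl) = tgt G e , tgt-edge e , inj₂ refl

  module _ (G H : Graph) where

    private
      srcᵘ tgtᵘ : Fin (E G + E H) → Fin (V G + V H)
      srcᵘ = copair (λ e → src G e ↑ˡ V H) (λ e → V G ↑ʳ src H e)
      tgtᵘ = copair (λ e → tgt G e ↑ˡ V H) (λ e → V G ↑ʳ tgt H e)

      srcᵘ-↑ˡ : ∀ e → srcᵘ (e ↑ˡ E H) ≡ src G e ↑ˡ V H
      srcᵘ-↑ˡ = copair-↑ˡ (λ e → src G e ↑ˡ V H) (λ e → V G ↑ʳ src H e)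
      tgtᵘ-↑ˡ : ∀ e → tgtᵘ (e ↑ˡ E H) ≡ tgt G e ↑ˡ V H
      tgtᵘ-↑ˡ = copair-↑ˡ (λ e → tgt G e ↑ˡ V H) (λ e → V G ↑ʳ tgt H e)
      srcᵘ-↑ʳ : ∀ e → srcᵘ (E G ↑ʳ e) ≡ V G ↑ʳ src H e
      srcᵘ-↑ʳ = copair-↑ʳ (λ e → src G e ↑ˡ V H) (λ e → V G ↑ʳ src H e)
      tgtᵘ-↑ʳ : ∀ e → tgtᵘ (E G ↑ʳ e) ≡ V G ↑ʳ tgt H e
      tgtᵘ-↑ʳ = copair-↑ʳ (λ e → tgt G e ↑ˡ V H) (λ e → V G ↑ʳ tgt H e)

      loopless-⊕ : ∀ e → srcᵘ e ≢ tgtᵘ e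
      loopless-⊕ e with side (E G) e
      ... | left e′ = λ eq → loopless G e′ (↑ˡ-injective (V H) _ _ (trans (sym (srcᵘ-↑ˡ e′)) (trans eq (tgtᵘ-↑ˡ e′))))
      ... | right e′ = λ eq → loopless H e′ (↑ʳ-injective (V G) _ _ (trans (sym (srcᵘ-↑ʳ e′)) (trans eq (tgtᵘ-↑ʳ e′))))

      noParallel-⊕ : ∀ e f → SameEnds (srcᵘ e) (tgtᵘ e) (srcᵘ f) (tgtᵘ f) → e ≡ f
      noParallel-⊕ e f with side (E G) e | side (E G) f
      ... | left e′ | left f′ = λ same → cong (_↑ˡ E H) (noParallel G e′ f′ (sameEnds-injective (↑ˡ-injective (V H) _ _)
            (sameEnds-cong (srcᵘ-↑ˡ e′) (tgtᵘ-↑ˡ e′) (srcᵘ-↑ˡ f′) (tgtᵘ-↑ˡ f′) same)))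
      ... | right e′ | right f′ = λ same → cong (E G ↑ʳ_) (noParallel H e′ f′ (sameEnds-injective (↑ʳ-injective (V G) _ _)
            (sameEnds-cong (srcᵘ-↑ʳ e′) (tgtᵘ-↑ʳ e′) (srcᵘ-↑ʳ f′) (tgtᵘ-↑ʳ f′) same)))
      ... | left e′ | right f′ = λ same → ⊥-elim (sameEnds-disjoint ↑ˡ≢↑ʳ ↑ˡ≢↑ʳ
            (sameEnds-cong (srcᵘ-↑ˡ e′) (tgtᵘ-↑ˡ e′) (srcᵘ-↑ʳ f′) (tgtᵘ-↑ʳ f′) same))
      ... | right e′ | left f′ = λ same → ⊥-elim (sameEnds-disjoint (↑ˡ≢↑ʳ ∘ sym) (↑ˡ≢↑ʳ ∘ sym)
            (sameEnds-cong (srcᵘ-↑ʳ e′) (tgtᵘ-↑ʳ e′) (srcᵘ-↑ˡ f′) (tgtᵘ-↑ˡ f′) same))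

    _⊕_ : Graph
    _⊕_ = record
      { V = V G + V H ; E = E G + E H ; src = srcᵘ ; tgt = tgtᵘ
      ; loopless = loopless-⊕ ; noParallel = noParallel-⊕ }

    inl : G ↪ _⊕_
    inl = record
      { vertex = _↑ˡ V H ; edge = _↑ˡ E H
      ; vertex-injective = ↑ˡ-injective (V H) _ _ ; edge-injective = ↑ˡ-injective (E H) _ _
      ; src-edge = srcᵘ-↑ˡ ; tgt-edge = tgtᵘ-↑ˡ }

    inr : H ↪ _⊕_
    inr = record
      { vertex = V G ↑ʳ_ ; edge = E G ↑ʳ_
      ; vertex-injective = ↑ʳ-injective (V G) _ _ ; edge-injective = ↑ʳ-injective (E G) _ _
      ; src-edge = srcᵘ-↑ʳ ; tgt-edge = tgtᵘ-↑ʳ }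

    private
      module L = _↪_ inl
      module R = _↪_ inr

    ¬incident-↑ʳ-↑ˡ : ∀ {v e} → ¬ Incident _⊕_ (E G ↑ʳ e) (v ↑ˡ V H)
    ¬incident-↑ʳ-↑ˡ inc with R.incident-image inc
    ... | _ , v↑ˡ≡w↑ʳ , _ = ↑ˡ≢↑ʳ v↑ˡ≡w↑ʳ

    ¬incident-↑ˡ-↑ʳ : ∀ {v e} → ¬ Incident _⊕_ (e ↑ˡ E H) (V G ↑ʳ v)
    ¬incident-↑ˡ-↑ʳ inc with L.incident-image inc
    ... | _ , v↑ʳ≡w↑ˡ , _ = ↑ˡ≢↑ʳ (sym v↑ʳ≡w↑ˡ)

  tabulate-+ : ∀ {m n} {A : Set} (f : Fin (m + n) → A) → tabulate f ≡ tabulate (f ∘ (_↑ˡ n)) ++ tabulate (f ∘ (m ↑ʳ_))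
  tabulate-+ {zero}  f = refl
  tabulate-+ {suc m} {n} f = cong (f zero ∷_) (tabulate-+ {m} {n} (f ∘ suc))

  module _ {A B : Set} {P : Pred A 0ℓ} {Q : Pred B 0ℓ} (P? : Decidable P) (Q? : Decidable Q) where

    length-filter-tabulate : ∀ {n} {f : Fin n → A} {g : Fin n → B} →
      (∀ i → P (f i) → Q (g i)) → (∀ i → Q (g i) → P (f i)) →
      length (filter P? (tabulate f)) ≡ length (filter Q? (tabulate g))
    length-filter-tabulate {zero} _ _ = refl
    length-filter-tabulate {suc n} {f} {g} to from with P? (f zero) | Q? (g zero)
    ... | yes _ | yes _ = cong suc (length-filter-tabulate (to ∘ suc) (from ∘ suc))
    ... | no _  | no _  = length-filter-tabulate (to ∘ suc) (from ∘ suc)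
    ... | yes p | no ¬q = ⊥-elim (¬q (to zero p))
    ... | no ¬p | yes q = ⊥-elim (¬p (from zero q))

  length-filter-allFin-+ : ∀ {m n} {P : Pred (Fin (m + n)) 0ℓ} (P? : Decidable P) →
    length (filter P? (allFin (m + n))) ≡ length (filter P? (tabulate (_↑ˡ n))) + length (filter P? (tabulate (m ↑ʳ_)))
  length-filter-allFin-+ {m} {n} P? = begin
    length (filter P? (allFin (m + n)))                                      ≡⟨ cong (length ∘ filter P?) (tabulate-+ {m} {n} (λ i → i)) ⟩
    length (filter P? (tabulate (_↑ˡ n) ++ tabulate (m ↑ʳ_)))                ≡⟨ cong length (filter-++ P? (tabulate (_↑ˡ n)) _) ⟩
    length (filter P? (tabulate (_↑ˡ n)) ++ filter P? (tabulate (m ↑ʳ_)))    ≡⟨ length-++ (filter P? (tabulate (_↑ˡ n))) ⟩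
    length (filter P? (tabulate (_↑ˡ n))) + length (filter P? (tabulate (m ↑ʳ_)))  ∎
    where open ≡-Reasoning

  module _ {G H : Graph} where

    private
      module L = _↪_ (inl G H)
      module R = _↪_ (inr G H)

    degree-⊕ˡ : ∀ v → degree (G ⊕ H) (v ↑ˡ V H) ≡ degree G v
    degree-⊕ˡ v = begin
      degree (G ⊕ H) (v ↑ˡ V H)                                                    ≡⟨ length-filter-allFin-+ {E G} {E H} P? ⟩
      length (filter P? (tabulate (_↑ˡ E H))) + length (filter P? (tabulate (E G ↑ʳ_)))
        ≡⟨ cong₂ _+_ (length-filter-tabulate P? (λ e → incident? G e v) {f = _↑ˡ E H} {g = λ e → e} (λ _ → L.incident⁻) (λ _ → L.incident⁺))
                     (cong length (filter-none P? {xs = tabulate (E G ↑ʳ_)} (tabulate⁺ (λ _ → ¬incident-↑ʳ-↑ˡ G H)))) ⟩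
      degree G v + 0                                                               ≡⟨ +-identityʳ (degree G v) ⟩
      degree G v                                                                   ∎
      where
      open ≡-Reasoning
      P? = λ e → incident? (G ⊕ H) e (v ↑ˡ V H)

    degree-⊕ʳ : ∀ v → degree (G ⊕ H) (V G ↑ʳ v) ≡ degree H v
    degree-⊕ʳ v = begin
      degree (G ⊕ H) (V G ↑ʳ v)                                                    ≡⟨ length-filter-allFin-+ {E G} {E H} P? ⟩
      length (filter P? (tabulate (_↑ˡ E H))) + length (filter P? (tabulate (E G ↑ʳ_)))
        ≡⟨ cong₂ _+_ (cong length (filter-none P? {xs = tabulate (_↑ˡ E H)} (tabulate⁺ (λ _ → ¬incident-↑ˡ-↑ʳ G H))))
                     (length-filter-tabulate P? (λ e → incident? H e v) {f = E G ↑ʳ_} {g = λ e → e} (λ _ → R.incident⁻) (λ _ → R.incident⁺)) ⟩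
      degree H v                                                                   ∎
      where
      open ≡-Reasoning
      P? = λ e → incident? (G ⊕ H) e (V G ↑ʳ v)

    maxDegree-⊕ : ∀ {k} → MaxDegreeAtMost k G → MaxDegreeAtMost k H → MaxDegreeAtMost k (G ⊕ H)
    maxDegree-⊕ {k} ΔG ΔH v with side (V G) v
    ... | left u  = subst (_≤ k) (sym (degree-⊕ˡ u)) (ΔG u)
    ... | right u = subst (_≤ k) (sym (degree-⊕ʳ u)) (ΔH u)


module Drawings where

  open Plane
  open Graphs
  open import Data.Nat using (ℕ; _+_)
  open import Data.Nat.Properties using (m+n≡0⇒m≡0; m+n≡0⇒n≡0)
  open import Data.Fin as Fin using (Fin; _↑ˡ_; _↑ʳ_; _≟_)
  open import Data.List using (List; []; _∷_; length; map; tabulate; allFin; _++_)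
  open import Data.List.Properties using (map-tabulate)
  open import Data.Nat.ListAction using (sum)
  open import Data.Nat.ListAction.Properties using (sum-++)
  open import Data.Rational using (ℚ; 0ℚ; _<_; _≤_)
  open import Data.Rational.Properties as ℚ using (<-irrefl; <-≤-trans; ≤-trans)
  open import Data.Product using (Σ; _×_; _,_; proj₁)
  open import Data.Sum using (_⊎_; inj₁; inj₂)
  open import Data.Empty using (⊥; ⊥-elim)
  open import Data.Unit using (tt)
  open import Function using (_∘_)
  open import Relation.Binary.PropositionalEquality
  open import Relation.Nullary using (¬_; Dec; ¬?)
  open import Relation.Nullary.Decidable using (_×-dec_; _⊎-dec_)

  module _ {G U : Graph} (ι : G ↪ U) where
    open _↪_ ι

    restrict : Drawing U → Drawing G
    restrict D = record { pos = pos D ∘ vertex ; bends = bends D ∘ edge }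

    arc-restrict : ∀ D e → arc (restrict D) e ≡ arc D (edge e)
    arc-restrict D e = cong₂ (λ s t → pos D s ∷ (bends D (edge e) ++ (pos D t ∷ []))) (sym (src-edge e)) (sym (tgt-edge e))

    restrict-planarOctilinear : ∀ {D} → PlanarOctilinear D → PlanarOctilinear (restrict D)
    restrict-planarOctilinear {D} ((grid , octilinear) , injective , simple , off-edge , meet) =
        ((grid ∘ vertex) , (λ e → subst (AllSegs OctilinearSeg) (sym (arc-restrict D e)) (octilinear (edge e))))
      , (λ u v eq → vertex-injective (injective _ _ eq))
      , (λ e → subst SimplePoly (sym (arc-restrict D e)) (simple (edge e)))
      , (λ e w ¬inc on → off-edge (edge e) (vertex w) (¬inc ∘ incident⁻) (subst (OnPoly _) (arc-restrict D e) on))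
      , meet-restrict
      where
      meet-restrict : ∀ e f p → e ≢ f → OnPoly p (arc (restrict D) e) → OnPoly p (arc (restrict D) f) →
        Σ (Fin (V G)) λ w → p ≡ pos D (vertex w) × Incident G e w × Incident G f w
      meet-restrict e f p e≢f on-e on-f
        with meet (edge e) (edge f) p (e≢f ∘ edge-injective)
                  (subst (OnPoly p) (arc-restrict D e) on-e) (subst (OnPoly p) (arc-restrict D f) on-f)
      ... | w , p≡w , inc-e , inc-f with incident-image inc-e
      ...   | w′ , refl , inc-e′ = w′ , p≡w , inc-e′ , incident⁻ inc-f

  totalBends-⊕ : ∀ {G H} (D : Drawing (G ⊕ H)) →
    totalBends D ≡ totalBends (restrict (inl G H) D) + totalBends (restrict (inr G H) D)
  totalBends-⊕ {G} {H} D = begin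
    sum (map b (allFin (E G + E H)))                                 ≡⟨ cong sum (map-tabulate (λ e → e) b) ⟩
    sum (tabulate b)                                                 ≡⟨ cong sum (tabulate-+ {E G} {E H} b) ⟩
    sum (tabulate (b ∘ (_↑ˡ E H)) ++ tabulate (b ∘ (E G ↑ʳ_)))       ≡⟨ sum-++ (tabulate (b ∘ (_↑ˡ E H))) _ ⟩
    sum (tabulate (b ∘ (_↑ˡ E H))) + sum (tabulate (b ∘ (E G ↑ʳ_)))  ≡⟨ cong₂ _+_ (cong sum (map-tabulate (λ e → e) (b ∘ (_↑ˡ E H))))
                                                                                  (cong sum (map-tabulate (λ e → e) (b ∘ (E G ↑ʳ_)))) ⟨
    sum (map (b ∘ (_↑ˡ E H)) (allFin (E G))) + sum (map (b ∘ (E G ↑ʳ_)) (allFin (E H)))  ∎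
    where
    open ≡-Reasoning
    b = λ e → length (bends D e)

  sum-tabulate≡0 : ∀ {n} (f : Fin n → ℕ) → sum (tabulate f) ≡ 0 → ∀ i → f i ≡ 0
  sum-tabulate≡0 f none Fin.zero    = m+n≡0⇒m≡0 (f Fin.zero) none
  sum-tabulate≡0 f none (Fin.suc i) = sum-tabulate≡0 (f ∘ Fin.suc) (m+n≡0⇒n≡0 (f Fin.zero) none) i

  totalBends≡0⇒bendFree : ∀ {G} (D : Drawing G) → totalBends D ≡ 0 → BendFree D
  totalBends≡0⇒bendFree {G} D none e = length≡0⇒[] (sum-tabulate≡0 b (trans (sym (cong sum (map-tabulate {n = E G} (λ e → e) b))) none) e)
    where
    b = λ e → length (bends D e)
    length≡0⇒[] : ∀ {xs : List Point} → length xs ≡ 0 → xs ≡ []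
    length≡0⇒[] {[]} _ = refl

  straight : ∀ {G} → (Fin (V G) → Point) → Drawing G
  straight pos = record { pos = pos ; bends = λ _ → [] }

  OnEdge : (G : Graph) → (Fin (V G) → Point) → Fin (E G) → Point → Set
  OnEdge G pos e p = OnSeg p (pos (src G e)) (pos (tgt G e))

  record StraightLinePlanar (G : Graph) (pos : Fin (V G) → Point) : Set where
    field
      injective       : ∀ u v → pos u ≡ pos v → u ≡ v
      vertex-off-edge : ∀ e w → ¬ Incident G e w → ¬ OnEdge G pos e (pos w)
      edges-meet-at-ends : ∀ e f p → e ≢ f → OnEdge G pos e p → OnEdge G pos f p →
                           Σ (Fin (V G)) λ w → p ≡ pos w × Incident G e w × Incident G f w

  module _ {G : Graph} {pos : Fin (V G) → Point} (S : StraightLinePlanar G pos) where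
    open StraightLinePlanar S

    straight-planar : PlanarDrawing (straight {G} pos)
    straight-planar =
        injective
      , (λ e → (loopless G e ∘ injective _ _) , (λ _ _ ()) , tt)
      , (λ e w ¬inc → vertex-off-edge e w ¬inc ∘ on-edge e)
      , (λ e f p e≢f on-e on-f → edges-meet-at-ends e f p e≢f (on-edge e on-e) (on-edge f on-f))
      where
      on-edge : ∀ e {p} → OnPoly p (arc (straight {G} pos) e) → OnEdge G pos e p
      on-edge e (inj₁ on) = on

    translate-planar : ∀ d → StraightLinePlanar G (λ v → pos v +ₚ d)
    translate-planar d = record
      { injective = λ u v eq → injective u v (+ₚ-injective d eq)
      ; vertex-off-edge = λ e w ¬inc on → vertex-off-edge e w ¬inc (onSeg-translate⁻ {pos w} {pos (src G e)} {pos (tgt G e)} d on)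
      ; edges-meet-at-ends = meet
      }
      where
      meet : ∀ e f p → e ≢ f → OnEdge G (λ v → pos v +ₚ d) e p → OnEdge G (λ v → pos v +ₚ d) f p →
        Σ (Fin (V G)) λ w → p ≡ pos w +ₚ d × Incident G e w × Incident G f w
      meet e f p e≢f on-e on-f with edges-meet-at-ends e f (p -ₚ d) e≢f
        (onSeg-translate {p} {pos (src G e)} {pos (tgt G e)} d on-e) (onSeg-translate {p} {pos (src G f)} {pos (tgt G f)} d on-f)
      ... | w , p-d≡w , inc-e , inc-f = w , trans (sym (-ₚ-+ₚ p d)) (cong (_+ₚ d) p-d≡w) , inc-e , inc-f

  module _ {G H : Graph} {f : Fin (V G) → Point} {g : Fin (V H) → Point} {a b : ℚ}
    (SG : StraightLinePlanar G f) (SH : StraightLinePlanar H g)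
    (f≤a : ∀ v → proj₁ (f v) ≤ a) (b≤g : ∀ v → b ≤ proj₁ (g v)) (a<b : a < b) where

    private
      module SG = StraightLinePlanar SG
      module SH = StraightLinePlanar SH
      module L = _↪_ (inl G H)
      module R = _↪_ (inr G H)

      place : Fin (V G + V H) → Point
      place = copair f g

      apart : ∀ {x} → x ≤ a → b ≤ x → ⊥
      apart x≤a b≤x = <-irrefl refl (<-≤-trans a<b (≤-trans b≤x x≤a))

      place-↑ˡ : ∀ v → place (v ↑ˡ V H) ≡ f v
      place-↑ˡ = copair-↑ˡ f g

      place-↑ʳ : ∀ v → place (V G ↑ʳ v) ≡ g v
      place-↑ʳ = copair-↑ʳ f g

      x-↑ˡ : ∀ v → proj₁ (place (v ↑ˡ V H)) ≤ a
      x-↑ˡ v = subst (λ q → proj₁ q ≤ a) (sym (place-↑ˡ v)) (f≤a v)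

      x-↑ʳ : ∀ v → b ≤ proj₁ (place (V G ↑ʳ v))
      x-↑ʳ v = subst (λ q → b ≤ proj₁ q) (sym (place-↑ʳ v)) (b≤g v)

      onEdge-↑ˡ : ∀ {e p} → OnEdge (G ⊕ H) place (e ↑ˡ E H) p → OnEdge G f e p
      onEdge-↑ˡ {e} {p} = subst₂ (OnSeg p) (trans (cong place (L.src-edge e)) (place-↑ˡ (src G e)))
                                           (trans (cong place (L.tgt-edge e)) (place-↑ˡ (tgt G e)))

      onEdge-↑ʳ : ∀ {e p} → OnEdge (G ⊕ H) place (E G ↑ʳ e) p → OnEdge H g e p
      onEdge-↑ʳ {e} {p} = subst₂ (OnSeg p) (trans (cong place (R.src-edge e)) (place-↑ʳ (src H e)))
                                           (trans (cong place (R.tgt-edge e)) (place-↑ʳ (tgt H e)))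

      x-onEdgeˡ : ∀ {e p} → OnEdge G f e p → proj₁ p ≤ a
      x-onEdgeˡ {e} {p} on = onSeg-x≤ {p} {f (src G e)} {f (tgt G e)} on (f≤a (src G e)) (f≤a (tgt G e))

      x-onEdgeʳ : ∀ {e p} → OnEdge H g e p → b ≤ proj₁ p
      x-onEdgeʳ {e} {p} on = onSeg-x≥ {p} {g (src H e)} {g (tgt H e)} on (b≤g (src H e)) (b≤g (tgt H e))

      injective : ∀ u v → place u ≡ place v → u ≡ v
      injective u v eq with side (V G) u | side (V G) v
      ... | left u′  | left v′  = cong (_↑ˡ V H) (SG.injective u′ v′ (trans (sym (place-↑ˡ u′)) (trans eq (place-↑ˡ v′))))
      ... | right u′ | right v′ = cong (V G ↑ʳ_) (SH.injective u′ v′ (trans (sym (place-↑ʳ u′)) (trans eq (place-↑ʳ v′))))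
      ... | left u′  | right v′ = ⊥-elim (apart (x-↑ˡ u′) (subst (λ q → b ≤ proj₁ q) (sym eq) (x-↑ʳ v′)))
      ... | right u′ | left v′  = ⊥-elim (apart (x-↑ˡ v′) (subst (λ q → b ≤ proj₁ q) eq (x-↑ʳ u′)))

      vertex-off-edge : ∀ e w → ¬ Incident (G ⊕ H) e w → ¬ OnEdge (G ⊕ H) place e (place w)
      vertex-off-edge e w ¬inc on with side (E G) e | side (V G) w
      ... | left e′  | left w′  = SG.vertex-off-edge e′ w′ (¬inc ∘ L.incident⁺) (subst (OnEdge G f e′) (place-↑ˡ w′) (onEdge-↑ˡ on))
      ... | right e′ | right w′ = SH.vertex-off-edge e′ w′ (¬inc ∘ R.incident⁺) (subst (OnEdge H g e′) (place-↑ʳ w′) (onEdge-↑ʳ on))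
      ... | left e′  | right w′ = apart (x-onEdgeˡ (onEdge-↑ˡ on)) (x-↑ʳ w′)
      ... | right e′ | left w′  = apart (x-↑ˡ w′) (x-onEdgeʳ (onEdge-↑ʳ on))

      edges-meet-at-ends : ∀ e f p → e ≢ f → OnEdge (G ⊕ H) place e p → OnEdge (G ⊕ H) place f p →
        Σ (Fin (V G + V H)) λ w → p ≡ place w × Incident (G ⊕ H) e w × Incident (G ⊕ H) f w
      edges-meet-at-ends e f p e≢f on-e on-f with side (E G) e | side (E G) f
      ... | left e′ | left f′ with SG.edges-meet-at-ends e′ f′ p (e≢f ∘ cong (_↑ˡ E H)) (onEdge-↑ˡ on-e) (onEdge-↑ˡ on-f)
      ...   | w , p≡w , inc-e , inc-f = w ↑ˡ V H , trans p≡w (sym (place-↑ˡ w)) , L.incident⁺ inc-e , L.incident⁺ inc-f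
      edges-meet-at-ends e f p e≢f on-e on-f | right e′ | right f′
        with SH.edges-meet-at-ends e′ f′ p (e≢f ∘ cong (E G ↑ʳ_)) (onEdge-↑ʳ on-e) (onEdge-↑ʳ on-f)
      ...   | w , p≡w , inc-e , inc-f = V G ↑ʳ w , trans p≡w (sym (place-↑ʳ w)) , R.incident⁺ inc-e , R.incident⁺ inc-f
      edges-meet-at-ends e f p e≢f on-e on-f | left e′ | right f′ = ⊥-elim (apart (x-onEdgeˡ (onEdge-↑ˡ on-e)) (x-onEdgeʳ (onEdge-↑ʳ on-f)))
      edges-meet-at-ends e f p e≢f on-e on-f | right e′ | left f′ = ⊥-elim (apart (x-onEdgeˡ (onEdge-↑ˡ on-f)) (x-onEdgeʳ (onEdge-↑ʳ on-e)))

    ⊕-planar : StraightLinePlanar (G ⊕ H) (copair f g)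
    ⊕-planar = record { injective = injective ; vertex-off-edge = vertex-off-edge ; edges-meet-at-ends = edges-meet-at-ends }

  module _ {G : Graph} (D : Drawing G) (bend-free : BendFree D) where

    straight-arc : ∀ e → arc D e ≡ pos D (src G e) ∷ pos D (tgt G e) ∷ []
    straight-arc e = cong (λ bs → pos D (src G e) ∷ (bs ++ pos D (tgt G e) ∷ [])) (bend-free e)

    joins-onPoly : ∀ {e u v p} → Joins G e u v → OnSeg p (pos D u) (pos D v) → OnPoly p (arc D e)
    joins-onPoly {e} {p = p} (inj₁ (refl , refl)) on = subst (OnPoly p) (sym (straight-arc e)) (inj₁ on)
    joins-onPoly {e} {p = p} (inj₂ (refl , refl)) on =
      subst (OnPoly p) (sym (straight-arc e)) (inj₁ (onSeg-sym {p} {pos D (tgt G e)} {pos D (src G e)} on))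

    joins-aligned : (∀ e → AllSegs OctilinearSeg (arc D e)) → ∀ {e u v} → Joins G e u v → Aligned (pos D u) (pos D v)
    joins-aligned octilinear {e} (inj₁ (refl , refl)) =
      octilinear⇒aligned (proj₁ (subst (AllSegs OctilinearSeg) (straight-arc e) (octilinear e)))
    joins-aligned octilinear {e} (inj₂ (refl , refl)) =
      aligned-sym (octilinear⇒aligned (proj₁ (subst (AllSegs OctilinearSeg) (straight-arc e) (octilinear e))))

  -- Decidable certificate that straight edges e and f meet only in a common endpoint: they share an
  -- endpoint and are not collinear, or one of them lies strictly on one side of the other's line.
  module _ {G : Graph} (place : Fin (V G) → Point) where

    private
      s t : Fin (E G) → Point
      s e = place (src G e)
      t e = place (tgt G e)

    NonCrossing : Fin (E G) → Fin (E G) → Set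
    NonCrossing e f =
        (src G e ≡ src G f × orient (s e) (t e) (t f) ≢ 0ℚ)
      ⊎ (src G e ≡ tgt G f × orient (s e) (t e) (s f) ≢ 0ℚ)
      ⊎ (tgt G e ≡ src G f × orient (t e) (s e) (t f) ≢ 0ℚ)
      ⊎ (tgt G e ≡ tgt G f × orient (t e) (s e) (s f) ≢ 0ℚ)
      ⊎ StrictlyBeside (s e) (t e) (s f) (t f)
      ⊎ StrictlyBeside (s f) (t f) (s e) (t e)

    nonCrossing-meet : ∀ e f {p} → NonCrossing e f → OnEdge G place e p → OnEdge G place f p →
      Σ (Fin (V G)) λ w → p ≡ place w × Incident G e w × Incident G f w
    nonCrossing-meet e f {p} (inj₁ (s≡s , fan)) on-e on-f =
      src G e , fan-apex {p} {s e} {t e} {t f} fan on-e (subst (λ v → OnSeg p (place v) (t f)) (sym s≡s) on-f) , inj₁ refl , inj₁ (sym s≡s)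
    nonCrossing-meet e f {p} (inj₂ (inj₁ (s≡t , fan))) on-e on-f =
      src G e , fan-apex {p} {s e} {t e} {s f} fan on-e (subst (λ v → OnSeg p (place v) (s f)) (sym s≡t) (onSeg-sym {p} {s f} {t f} on-f))
      , inj₁ refl , inj₂ (sym s≡t)
    nonCrossing-meet e f {p} (inj₂ (inj₂ (inj₁ (t≡s , fan)))) on-e on-f =
      tgt G e , fan-apex {p} {t e} {s e} {t f} fan (onSeg-sym {p} {s e} {t e} on-e) (subst (λ v → OnSeg p (place v) (t f)) (sym t≡s) on-f)
      , inj₂ refl , inj₁ (sym t≡s)
    nonCrossing-meet e f {p} (inj₂ (inj₂ (inj₂ (inj₁ (t≡t , fan))))) on-e on-f =
      tgt G e , fan-apex {p} {t e} {s e} {s f} fan (onSeg-sym {p} {s e} {t e} on-e)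
                         (subst (λ v → OnSeg p (place v) (s f)) (sym t≡t) (onSeg-sym {p} {s f} {t f} on-f))
      , inj₂ refl , inj₂ (sym t≡t)
    nonCrossing-meet e f {p} (inj₂ (inj₂ (inj₂ (inj₂ (inj₁ beside))))) on-e on-f =
      ⊥-elim (strictlyBeside-disjoint {p} {s e} {t e} {s f} {t f} beside on-e on-f)
    nonCrossing-meet e f {p} (inj₂ (inj₂ (inj₂ (inj₂ (inj₂ beside))))) on-e on-f =
      ⊥-elim (strictlyBeside-disjoint {p} {s f} {t f} {s e} {t e} beside on-f on-e)

    nonCrossing? : ∀ e f → Dec (NonCrossing e f)
    nonCrossing? e f =
            ((src G e ≟ src G f) ×-dec ¬? (orient (s e) (t e) (t f) ℚ.≟ 0ℚ))
      ⊎-dec ((src G e ≟ tgt G f) ×-dec ¬? (orient (s e) (t e) (s f) ℚ.≟ 0ℚ))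
      ⊎-dec ((tgt G e ≟ src G f) ×-dec ¬? (orient (t e) (s e) (t f) ℚ.≟ 0ℚ))
      ⊎-dec ((tgt G e ≟ tgt G f) ×-dec ¬? (orient (t e) (s e) (s f) ℚ.≟ 0ℚ))
      ⊎-dec strictlyBeside? (s e) (t e) (s f) (t f)
      ⊎-dec strictlyBeside? (s f) (t f) (s e) (t e)

module K4Drawings where

  open Plane
  open Configurations
  open Graphs
  open Drawings
  open import Data.Nat as ℕ using (ℕ; _+_; _*_)
  open import Data.Nat.Properties as ℕ using (n≢0⇒n>0; *-distribˡ-+; +-mono-≤; *-monoʳ-≤)
  open import Data.Integer using (+_)
  open import Data.Fin using (Fin; _≟_)
  open import Data.Fin.Properties using (all?)
  open import Data.Rational using (0ℚ; _≤_)
  open import Data.Rational.Properties as ℚ using (_≤?_)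
  open import Data.Product using (Σ; _×_; _,_; proj₁)
  open import Data.Product.Properties using (≡-dec)
  open import Data.Sum using (inj₁; [_,_]′)
  open import Data.Empty using (⊥-elim)
  open import Data.Unit using (tt)
  open import Data.Vec using (lookup; _∷_; [])
  open import Function using (_∘_)
  open import Relation.Binary.PropositionalEquality
  open import Relation.Nullary using (¬_; yes; no; ¬?)
  open import Relation.Nullary.Decidable using (toWitness; _×-dec_; _→-dec_)

  bendFree⇒OctilinearK4 : (D : Drawing K4) → PlanarOctilinear D → BendFree D → OctilinearK4 (pos D)
  bendFree⇒OctilinearK4 D ((_ , octilinear) , injective , _ , off-edge , meet) bend-free = record
    { injective       = injective _ _
    ; aligned         = aligned
    ; vertex-off-edge = vertex-off-edge
    ; edges-disjoint  = edges-disjoint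
    }
    where
    aligned : ∀ {i j} → i ≢ j → Aligned (pos D i) (pos D j)
    aligned {i} {j} i≢j with K4-complete i j i≢j
    ... | e , e-ij = joins-aligned D bend-free octilinear {e} e-ij

    vertex-off-edge : ∀ {i j k} → i ≢ j → i ≢ k → j ≢ k → ¬ OnSeg (pos D i) (pos D j) (pos D k)
    vertex-off-edge {i} {j} {k} i≢j i≢k j≢k on with K4-complete j k j≢k
    ... | e , e-jk = off-edge e i ([ i≢j , i≢k ]′ ∘ joins-incident {K4} {e} e-jk) (joins-onPoly D bend-free e-jk on)

    edges-disjoint : ∀ {i j k l} → i ≢ j → k ≢ l → i ≢ k → i ≢ l → j ≢ k → j ≢ l →
                     ∀ {p} → OnSeg p (pos D i) (pos D j) → ¬ OnSeg p (pos D k) (pos D l)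
    edges-disjoint {i} {j} {k} {l} i≢j k≢l i≢k i≢l j≢k j≢l {p} on-ij on-kl
      with K4-complete i j i≢j | K4-complete k l k≢l
    ... | e , e-ij | f , f-kl with meet e f p e≢f (joins-onPoly D bend-free e-ij on-ij) (joins-onPoly D bend-free f-kl on-kl)
      where
      e≢f : e ≢ f
      e≢f e≡f = joins-disjoint {K4} {e} {f} e-ij f-kl i≢k i≢l j≢k j≢l (inj₁ refl) (subst (λ x → Incident K4 x (src K4 e)) e≡f (inj₁ refl))
    ...   | w , _ , inc-e , inc-f = joins-disjoint {K4} {e} {f} e-ij f-kl i≢k i≢l j≢k j≢l inc-e inc-f

  K4-noBendFreeDrawing : ¬ Σ (Drawing K4) λ D → PlanarOctilinear D × BendFree D
  K4-noBendFreeDrawing (D , planar-octilinear , bend-free) = no-octilinear-K4 (bendFree⇒OctilinearK4 D planar-octilinear bend-free)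

  K4-needs-a-bend : (D : Drawing K4) → PlanarOctilinear D → 1 ℕ.≤ totalBends D
  K4-needs-a-bend D planar-octilinear with totalBends D ℕ.≟ 0
  ... | yes none = ⊥-elim (K4-noBendFreeDrawing (D , planar-octilinear , totalBends≡0⇒bendFree D none))
  ... | no some  = n≢0⇒n>0 some

  BendBound : ℕ → Graph → Set
  BendBound c G = ∀ (D : Drawing G) → PlanarOctilinear D → V G ℕ.≤ c * totalBends D

  bendBound-K4⊕ : ∀ {H} → BendBound 4 H → BendBound 4 (K4 ⊕ H)
  bendBound-K4⊕ {H} bound D planar-octilinear = begin
    4 + V H                    ≤⟨ +-mono-≤ (*-monoʳ-≤ 4 (K4-needs-a-bend Dˡ (restrict-planarOctilinear (inl K4 H) planar-octilinear)))
                                           (bound Dʳ (restrict-planarOctilinear (inr K4 H) planar-octilinear)) ⟩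
    4 * totalBends Dˡ + 4 * totalBends Dʳ  ≡⟨ *-distribˡ-+ 4 (totalBends Dˡ) (totalBends Dʳ) ⟨
    4 * (totalBends Dˡ + totalBends Dʳ)    ≡⟨ cong (4 *_) (totalBends-⊕ {K4} {H} D) ⟨
    4 * totalBends D           ∎
    where
    open ℕ.≤-Reasoning
    Dˡ = restrict (inl K4 H) D
    Dʳ = restrict (inr K4 H) D

  point : ℕ → ℕ → Point
  point x y = fromℤ (+ x) , fromℤ (+ y)

  K4-place : Fin 4 → Point
  K4-place = lookup (point 0 0 ∷ point 4 0 ∷ point 0 4 ∷ point 1 1 ∷ [])

  K4-planar : StraightLinePlanar K4 K4-place
  K4-planar = record
    { injective = toWitness {a? = all? λ u → all? λ v → ≡-dec ℚ._≟_ ℚ._≟_ (K4-place u) (K4-place v) →-dec (u ≟ v)} tt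
    ; vertex-off-edge = λ e w ¬inc → off-segment {K4-place w} {end K4-src e} {end K4-tgt e}
        (toWitness {a? = all? λ e → all? λ w → ¬? (incident? K4 e w) →-dec ¬? (orient (end K4-src e) (end K4-tgt e) (K4-place w) ℚ.≟ 0ℚ)} tt e w ¬inc)
    ; edges-meet-at-ends = λ e f p e≢f → nonCrossing-meet {K4} K4-place e f
        (toWitness {a? = all? λ e → all? λ f → ¬? (e ≟ f) →-dec nonCrossing? {K4} K4-place e f} tt e f e≢f)
    }
    where
    end : (Fin 6 → Fin 4) → Fin 6 → Point
    end endpoint = K4-place ∘ endpoint

  K4-place-x : ∀ v → 0ℚ ≤ proj₁ (K4-place v) × proj₁ (K4-place v) ≤ fromℤ (+ 4)
  K4-place-x = toWitness {a? = all? λ v → (0ℚ ≤? proj₁ (K4-place v)) ×-dec (proj₁ (K4-place v) ≤? fromℤ (+ 4))} tt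

module Copies where

  open Plane
  open Graphs
  open Drawings
  open K4Drawings
  open import Data.Nat as ℕ using (ℕ; zero; suc; z≤n; s≤s)
  open import Data.Nat.Properties using (m≤n+m; m≤n⇒m≤1+n; ≤-trans)
  open import Data.Integer using (+_)
  open import Data.Fin using (Fin; _↑ˡ_)
  open import Data.Rational using (0ℚ; _≤_)
  open import Data.Rational.Properties as ℚ using (_≤?_; _<?_)
  open import Data.Product using (Σ; _×_; _,_; proj₁; proj₂)
  open import Data.Unit using (tt)
  open import Function using (_∘_)
  open import Relation.Binary.PropositionalEquality using (subst)
  open import Relation.Nullary using (¬_)
  open import Relation.Nullary.Decidable using (toWitness)

  copies : ℕ → Graph
  copies zero    = empty
  copies (suc k) = K4 ⊕ copies k

  copies-size : ∀ k → k ℕ.≤ V (copies k)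
  copies-size zero    = z≤n
  copies-size (suc k) = s≤s (≤-trans (copies-size k) (m≤n+m _ 3))

  copies-maxDegree : ∀ k → MaxDegreeAtMost 4 (copies k)
  copies-maxDegree zero    ()
  copies-maxDegree (suc k) = maxDegree-⊕ {K4} {copies k} (λ v → m≤n⇒m≤1+n (K4-maxDegree v)) (copies-maxDegree k)

  copies-drawing : ∀ k → Σ (Fin (V (copies k)) → Point) λ place →
    StraightLinePlanar (copies k) place × (∀ v → 0ℚ ≤ proj₁ (place v))
  copies-drawing zero = (λ ()) , record { injective = λ () ; vertex-off-edge = λ () ; edges-meet-at-ends = λ () } , λ ()
  copies-drawing (suc k) with copies-drawing k
  ... | place , planar , 0≤x =
      copair K4-place shifted
    , ⊕-planar {K4} {copies k} K4-planar (translate-planar planar (five , 0ℚ)) (proj₂ ∘ K4-place-x) 5≤x (toWitness {a? = fromℤ (+ 4) <? five} tt)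
    , copair-elim (λ q → 0ℚ ≤ proj₁ q) (proj₁ ∘ K4-place-x) (λ v → ℚ.≤-trans (toWitness {a? = 0ℚ ≤? five} tt) (5≤x v))
    where
    five = fromℤ (+ 5)
    shifted : Fin (V (copies k)) → Point
    shifted v = place v +ₚ (five , 0ℚ)
    5≤x : ∀ v → five ≤ proj₁ (shifted v)
    5≤x v = subst (_≤ proj₁ (shifted v)) (ℚ.+-identityˡ five) (ℚ.+-monoˡ-≤ five (0≤x v))

  copies-planar : ∀ k → Planar (copies k)
  copies-planar k = straight (proj₁ (copies-drawing k)) , straight-planar (proj₁ (proj₂ (copies-drawing k)))

  copies-bendBound : ∀ k → BendBound 4 (copies k)
  copies-bendBound zero    _ _ = z≤n
  copies-bendBound (suc k) = bendBound-K4⊕ (copies-bendBound k)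

  copies-noBendFreeDrawing : ∀ k → ¬ Σ (Drawing (copies (suc k))) λ D → PlanarOctilinear D × BendFree D
  copies-noBendFreeDrawing k (D , planar-octilinear , bend-free) = K4-noBendFreeDrawing
    (restrict (inl K4 (copies k)) D , restrict-planarOctilinear (inl K4 (copies k)) planar-octilinear , bend-free ∘ (_↑ˡ E (copies k)))

open Copies
open import Data.Nat using (ℕ; suc; _≤_; _*_)
open import Data.Nat.Properties using (≤-trans; n≤1+n)
open import Data.Product using (Σ; _×_; _,_)
open import Relation.Nullary using (¬_)

-- The bound on the number of bends holds for every planar octilinear drawing.
theorem2 : Σ ℕ λ c → ∀ (m : ℕ) → Σ Graph λ G →
    (m ≤ V G) ×
    KPlanar 4 G ×
    ¬ (Σ (Drawing G) λ D → PlanarOctilinear D × BendFree D) ×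
    (∀ (D : Drawing G) → PlanarOctilinear D → AtMostOneBendPerEdge D →
    V G ≤ c * totalBends D)
theorem2 = 4 , λ m → copies (suc m)
  , ≤-trans (n≤1+n m) (copies-size (suc m))
  , (copies-planar (suc m) , copies-maxDegree (suc m))
  , copies-noBendFreeDrawing m
  , λ D planar-octilinear _ → copies-bendBound (suc m) D planar-octilinear
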